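{- For all positive integers $b,k,h$, let $p_c(b,k,h)$ be the number of corner-polyominoes inscribed in the $b\times k\times h$ rectangular prism. Then $$p_c(b,k,h)=\begin{cases}2\binom{b+k+h-3}{b-1,\,k-1,\,h-1}-1 & \text{if } b=1 \text{ or } k=1 \text{ or } h=1,\\[4pt] 1+2\binom{b+k-2}{b-1}+2\binom{b+h-2}{b-1}+2\binom{k+h-2}{k-1}-6\\ \quad +\,p_c(b-1,k,h)+p_c(b,k-1,h)+p_c(b,k,h-1) & \text{otherwise.}\end{cases}$$
   Context: Cells are unit cubes indexed by integer triples $(i,j,l)$; two cells are adjacent if they differ by $1$ in exactly one coordinate (i.e. they share a face). A (3D) polyomino is a finite nonempty set of cells that is connected under this adjacency. A polyomino is inscribed in the $b\times k\times h$ rectangular prism if all its cells satisfy $1\le i\le b$, $1\le j\le k$, $1\le l\le h$, and it touches each of the six faces of the prism, i.e. it contains cells with $i=1$, with $i=b$, with $j=1$, with $j=k$, with $l=1$ and with $l=h$. The minimal possible volume (number of cells) of such an inscribed polyomino is $b+k+h-2$; "minimal" polyominoes are inscribed polyominoes with exactly this number of cells. A corner-polyomino inscribed in the prism is a minimal inscribed polyomino containing the corner cell $(1,1,1)$ of the prism (by symmetry, the count does not depend on which corner is fixed). $\binom{a+b+c}{a,b,c}=\frac{(a+b+c)!}{a!\,b!\,c!}$ denotes a trinomial coefficient. -}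

module Defs where

open import Data.Nat using (ℕ; zero; suc; _+_; _*_; _∸_; _≤_; NonZero; _!)
open import Data.Nat.Properties using (_!≢0; m*n≢0)
open import Data.Nat.DivMod using (_/_)
open import Data.Bool using (Bool; true; false)
open import Data.Fin using (Fin; toℕ)
open import Data.Vec using (Vec; lookup)
open import Data.List using (List; length)
open import Data.List.Membership.Propositional using (_∈_)
open import Data.List.Relation.Unary.Unique.Propositional using (Unique)
open import Data.Product using (Σ; ∃; _×_; _,_)
open import Data.Sum using (_⊎_)
open import Relation.Binary.PropositionalEquality using (_≡_)
open import Relation.Binary.Construct.Closure.ReflexiveTransitive using (Star)

trinomial : ℕ → ℕ → ℕ → ℕ
trinomial a b c = ((a + b + c) !) / (a ! * b ! * c !)
  where
  instance
    nz : NonZero (a ! * b ! * c !)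
    nz = m*n≢0 (a ! * b !) (c !) {{m*n≢0 (a !) (b !) {{a !≢0}} {{b !≢0}}}} {{c !≢0}}

-- The cell with indices (i , j , l) : Fin b × Fin k × Fin h corresponds to
-- the cell (toℕ i + 1 , toℕ j + 1 , toℕ l + 1) of the paper.
CellSet : ℕ → ℕ → ℕ → Set
CellSet b k h = Vec (Vec (Vec Bool h) k) b

Cell : ℕ → ℕ → ℕ → Set
Cell b k h = Fin b × Fin k × Fin h

_∈c_ : ∀ {b k h} → Cell b k h → CellSet b k h → Set
(i , j , l) ∈c S = lookup (lookup (lookup S i) j) l ≡ true

Differ1 : ∀ {n} → Fin n → Fin n → Set
Differ1 x y = (toℕ x ≡ suc (toℕ y)) ⊎ (toℕ y ≡ suc (toℕ x))

Adjacent : ∀ {b k h} → Cell b k h → Cell b k h → Set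
Adjacent (i , j , l) (i' , j' , l') =
    (Differ1 i i' × j ≡ j' × l ≡ l')
  ⊎ (i ≡ i' × Differ1 j j' × l ≡ l')
  ⊎ (i ≡ i' × j ≡ j' × Differ1 l l')

AdjIn : ∀ {b k h} → CellSet b k h → Cell b k h → Cell b k h → Set
AdjIn S c d = c ∈c S × d ∈c S × Adjacent c d

Connected : ∀ {b k h} → CellSet b k h → Set
Connected S = ∀ c d → c ∈c S → d ∈c S → Star (AdjIn S) c d

boolToℕ : Bool → ℕ
boolToℕ true = 1
boolToℕ false = 0

sumVec : ∀ {n} {A : Set} → (A → ℕ) → Vec A n → ℕ
sumVec f Vec.[] = 0
sumVec f (x Vec.∷ xs) = f x + sumVec f xs

size : ∀ {b k h} → CellSet b k h → ℕ
size S = sumVec (sumVec (sumVec boolToℕ)) S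

-- polyomino: nonempty, connected (finiteness is automatic)
IsPolyomino : ∀ {b k h} → CellSet b k h → Set
IsPolyomino S = (∃ λ c → c ∈c S) × Connected S

TouchesFaces : ∀ {b k h} → CellSet b k h → Set
TouchesFaces {b} {k} {h} S =
    (Σ (Cell b k h) λ { (i , j , l) → (i , j , l) ∈c S × toℕ i ≡ 0 })
  × (Σ (Cell b k h) λ { (i , j , l) → (i , j , l) ∈c S × toℕ i ≡ b ∸ 1 })
  × (Σ (Cell b k h) λ { (i , j , l) → (i , j , l) ∈c S × toℕ j ≡ 0 })
  × (Σ (Cell b k h) λ { (i , j , l) → (i , j , l) ∈c S × toℕ j ≡ k ∸ 1 })
  × (Σ (Cell b k h) λ { (i , j , l) → (i , j , l) ∈c S × toℕ l ≡ 0 })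
  × (Σ (Cell b k h) λ { (i , j , l) → (i , j , l) ∈c S × toℕ l ≡ h ∸ 1 })

IsInscribed : ∀ {b k h} → CellSet b k h → Set
IsInscribed S = IsPolyomino S × TouchesFaces S

IsMinimal : ∀ {b k h} → CellSet b k h → Set
IsMinimal {b} {k} {h} S = IsInscribed S × size S ≡ b + k + h ∸ 2

IsCornerPolyomino : ∀ {b k h} → CellSet b k h → Set
IsCornerPolyomino {b} {k} {h} S =
  IsMinimal S × (Σ (Cell b k h) λ { (i , j , l) → (i , j , l) ∈c S × toℕ i ≡ 0 × toℕ j ≡ 0 × toℕ l ≡ 0 })

HasCount : ∀ {b k h} → (CellSet b k h → Set) → ℕ → Set
HasCount {b} {k} {h} P n =
  Σ (List (CellSet b k h)) λ L → length L ≡ n × Unique L × (∀ S → (S ∈ L → P S) × (P S → S ∈ L))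

NumCornerPolyominoes : ℕ → ℕ → ℕ → ℕ → Set
NumCornerPolyominoes b k h n = HasCount (IsCornerPolyomino {b} {k} {h}) n

-- A corner polyomino has b + k + h - 2 cells, the least possible: a connected set of cells has at least
-- one cell more than the sum of its extents in the three directions. Sort corner polyominoes by which
-- neighbours of the corner cell they contain. If the neighbour in the first direction is present, remove
-- the corner cell; the component of that neighbour and the rest are both connected, so the cell count
-- leaves no slack. This forces the rest to be a corner polyomino of the face i = 1, the component to be a
-- corner polyomino of the prism one layer shorter, and each of the two other extents to be spanned by one
-- of the two parts alone. Gluing is the inverse, so this class is counted by a sum of products of smaller
-- counts; the classes of the other two neighbours reduce to it by rotating the axes, and without any
-- neighbour only the corner cell remains. Evaluating these sums gives the recurrence, and on a flat prism
-- they give Pascal's rule for 1 + p_c, whence p_c = 2 C(x + y, x) - 1 there.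

module Submission where

open import Defs
open import Data.Bool using (Bool; true; false; _∧_; _∨_; not)
open import Data.Bool.Properties using (∨-identityʳ) renaming (_≟_ to _≟ᵇ_)
open import Data.Empty using (⊥; ⊥-elim)
open import Data.Fin using (Fin; toℕ) renaming (zero to fzero; suc to fsuc)
open import Data.Fin.Properties using (toℕ-injective)
open import Data.List using (List; []; _∷_; length; map; _++_; cartesianProduct)
open import Data.List.Membership.Propositional using (_∈_)
open import Data.List.Membership.Propositional.Properties using (∈-map⁺; ∈-map⁻; ∈-++⁺ˡ; ∈-++⁺ʳ; ∈-++⁻; ∈-cartesianProduct⁺; ∈-cartesianProduct⁻)
open import Data.List.Membership.Propositional.Properties.WithK using (unique∧set⇒bag)
open import Data.List.Properties using (length-map; length-++)
open import Data.List.Relation.Binary.BagAndSetEquality using (∼bag⇒↭)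
open import Data.List.Relation.Binary.Permutation.Propositional.Properties using (↭-length)
open import Data.List.Relation.Unary.All using (All; []; _∷_)
open import Data.List.Relation.Unary.AllPairs using ([]; _∷_)
open import Data.List.Relation.Unary.Any using (here; there)
open import Data.List.Relation.Unary.Unique.Propositional using (Unique)
import Data.List.Relation.Unary.Unique.Propositional.Properties as Unique
open import Data.Nat
open import Data.Nat.Combinatorics using (_C_; nCk+nC[k+1]≡[n+1]C[k+1]; nCk≡nC[n∸k]; nCn≡1; nCk≡n!/k![n-k]!)
open import Data.Nat.DivMod using (/-congʳ)
open import Data.Nat.ListAction using (sum)
open import Data.Nat.Properties
open import Data.Nat.Tactic.RingSolver using (solve-∀)
open import Data.Product using (Σ; _×_; _,_; proj₁; proj₂)
open import Data.Product.Properties using (≡-dec)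
open import Data.Sum using (_⊎_; inj₁; inj₂; [_,_]′)
open import Data.Vec using (Vec; []; _∷_; lookup; tabulate; replicate)
open import Function using (_∘_)
open import Function.Bundles using (_⇔_; mk⇔)
open import Relation.Binary.Construct.Closure.ReflexiveTransitive using (Star; ε; _◅_; _◅◅_; gmap; reverse)
open import Relation.Binary.PropositionalEquality
open import Relation.Nullary using (¬_; Dec; yes; no)
open import Relation.Nullary.Decidable using (_×-dec_; _⊎-dec_; does; dec-true; dec-false)

Point : Set
Point = ℕ × ℕ × ℕ

ci cj cl : Point → ℕ
ci c = proj₁ c
cj c = proj₁ (proj₂ c)
cl c = proj₂ (proj₂ c)

origin e1 e2 e3 : Point
origin = 0 , 0 , 0
e1 = 1 , 0 , 0
e2 = 0 , 1 , 0
e3 = 0 , 0 , 1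

-- Cell sets are handled as indicator functions on all of ℕ³, with coordinates shifted to start at 0.
Shape : Set
Shape = ℕ → ℕ → ℕ → Bool

_∋_ : Shape → Point → Set
f ∋ c = f (ci c) (cj c) (cl c) ≡ true

_∌_ : Shape → Point → Set
f ∌ c = f (ci c) (cj c) (cl c) ≡ false

_⊆_ : Shape → Shape → Set
f ⊆ g = ∀ c → f ∋ c → g ∋ c

∌⇒¬∋ : ∀ f c → f ∌ c → ¬ f ∋ c
∌⇒¬∋ f c ∌c ∋c with () ← trans (sym ∋c) ∌c

¬∋⇒∌ : ∀ f c → ¬ f ∋ c → f ∌ c
¬∋⇒∌ f c ∉c with f (ci c) (cj c) (cl c)
... | true = ⊥-elim (∉c refl)
... | false = refl

∋⊎∌ : ∀ f c → f ∋ c ⊎ f ∌ c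
∋⊎∌ f c with f (ci c) (cj c) (cl c)
... | true = inj₁ refl
... | false = inj₂ refl

_∋?_ : ∀ f c → Dec (f ∋ c)
f ∋? c = f (ci c) (cj c) (cl c) ≟ᵇ true

_∌?_ : ∀ f c → Dec (f ∌ c)
f ∌? c = f (ci c) (cj c) (cl c) ≟ᵇ false

_≟ₚ_ : (c d : Point) → Dec (c ≡ d)
_≟ₚ_ = ≡-dec _≟_ (≡-dec _≟_ _≟_)

InBox : ℕ → ℕ → ℕ → Point → Set
InBox b k h c = ci c ≤ b × cj c ≤ k × cl c ≤ h

Within : ℕ → ℕ → ℕ → Shape → Set
Within b k h f = ∀ c → f ∋ c → InBox b k h c

Differ : ℕ → ℕ → Set
Differ x y = x ≡ suc y ⊎ y ≡ suc x

Adj : Point → Point → Set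
Adj c d = (Differ (ci c) (ci d) × cj c ≡ cj d × cl c ≡ cl d)
        ⊎ (ci c ≡ ci d × Differ (cj c) (cj d) × cl c ≡ cl d)
        ⊎ (ci c ≡ ci d × cj c ≡ cj d × Differ (cl c) (cl d))

Edge : Shape → Point → Point → Set
Edge f c d = f ∋ c × f ∋ d × Adj c d

Path : Shape → Point → Point → Set
Path f = Star (Edge f)

RootedAt : Shape → Point → Set
RootedAt f x = ∀ c → f ∋ c → Path f x c

IsConnected : Shape → Set
IsConnected f = ∀ c d → f ∋ c → f ∋ d → Path f c d

Differ-sym : ∀ {x y} → Differ x y → Differ y x
Differ-sym (inj₁ e) = inj₂ e
Differ-sym (inj₂ e) = inj₁ e

Differ? : ∀ x y → Dec (Differ x y)
Differ? x y = (x ≟ suc y) ⊎-dec (y ≟ suc x)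

Adj-sym : ∀ {c d} → Adj c d → Adj d c
Adj-sym (inj₁ (di , ej , el)) = inj₁ (Differ-sym di , sym ej , sym el)
Adj-sym (inj₂ (inj₁ (ei , dj , el))) = inj₂ (inj₁ (sym ei , Differ-sym dj , sym el))
Adj-sym (inj₂ (inj₂ (ei , ej , dl))) = inj₂ (inj₂ (sym ei , sym ej , Differ-sym dl))

Adj? : ∀ c d → Dec (Adj c d)
Adj? c d = (Differ? (ci c) (ci d) ×-dec (cj c ≟ cj d) ×-dec (cl c ≟ cl d))
   ⊎-dec ((ci c ≟ ci d) ×-dec Differ? (cj c) (cj d) ×-dec (cl c ≟ cl d))
   ⊎-dec ((ci c ≟ ci d) ×-dec (cj c ≟ cj d) ×-dec Differ? (cl c) (cl d))

Adj-origin : ∀ c → Adj origin c → c ≡ e1 ⊎ c ≡ e2 ⊎ c ≡ e3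
Adj-origin _ (inj₁ (inj₂ refl , refl , refl)) = inj₁ refl
Adj-origin _ (inj₂ (inj₁ (refl , inj₂ refl , refl))) = inj₂ (inj₁ refl)
Adj-origin _ (inj₂ (inj₂ (refl , refl , inj₂ refl))) = inj₂ (inj₂ refl)

path-reverse : ∀ {f c d} → Path f c d → Path f d c
path-reverse = reverse λ (∋c , ∋d , adj) → ∋d , ∋c , Adj-sym adj

path-mono : ∀ {f g} → f ⊆ g → ∀ {c d} → Path f c d → Path g c d
path-mono f⊆g = gmap (λ c → c) λ (∋c , ∋d , adj) → f⊆g _ ∋c , f⊆g _ ∋d , adj

rooted⇒connected : ∀ {f x} → RootedAt f x → IsConnected f
rooted⇒connected rooted c d ∋c ∋d = path-reverse (rooted c ∋c) ◅◅ rooted d ∋d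

⁅_⁆ : Point → Shape
⁅ c ⁆ i j l = does ((i , j , l) ≟ₚ c)

_∪_ : Shape → Shape → Shape
(f ∪ g) i j l = f i j l ∨ g i j l

_∖_ : Shape → Shape → Shape
(f ∖ g) i j l = f i j l ∧ not (g i j l)

∋⁅⁆ : ∀ c → ⁅ c ⁆ ∋ c
∋⁅⁆ c = dec-true (c ≟ₚ c) refl

∈⁅⁆⇒≡ : ∀ c d → ⁅ c ⁆ ∋ d → d ≡ c
∈⁅⁆⇒≡ c d ∋d with d ≟ₚ c
... | yes d≡c = d≡c

∉⁅⁆ : ∀ c d → d ≢ c → ⁅ c ⁆ ∌ d
∉⁅⁆ c d = dec-false (d ≟ₚ c)

∪-elim : ∀ f g c → (f ∪ g) ∋ c → f ∋ c ⊎ g ∋ c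
∪-elim f g c ∋c with f (ci c) (cj c) (cl c)
... | true = inj₁ refl
... | false = inj₂ ∋c

∪-introˡ : ∀ f g c → f ∋ c → (f ∪ g) ∋ c
∪-introˡ f g c ∋c rewrite ∋c = refl

∪-introʳ : ∀ f g c → g ∋ c → (f ∪ g) ∋ c
∪-introʳ f g c ∋c rewrite ∋c with f (ci c) (cj c) (cl c)
... | true = refl
... | false = refl

∖-intro : ∀ f g c → f ∋ c → g ∌ c → (f ∖ g) ∋ c
∖-intro f g c ∋c ∌c rewrite ∋c | ∌c = refl

∖-elim : ∀ f g c → (f ∖ g) ∋ c → f ∋ c × g ∌ c
∖-elim f g c ∋c with f (ci c) (cj c) (cl c) | g (ci c) (cj c) (cl c)
... | true | false = refl , refl

sumTo : ℕ → (ℕ → ℕ) → ℕ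
sumTo zero g = 0
sumTo (suc n) g = g 0 + sumTo n (g ∘ suc)

volume : ℕ → ℕ → ℕ → Shape → ℕ
volume b k h f = sumTo (suc b) λ i → sumTo (suc k) λ j → sumTo (suc h) λ l → boolToℕ (f i j l)

sumTo-cong : ∀ n {g g' : ℕ → ℕ} → (∀ i → i < n → g i ≡ g' i) → sumTo n g ≡ sumTo n g'
sumTo-cong zero e = refl
sumTo-cong (suc n) e = cong₂ _+_ (e 0 z<s) (sumTo-cong n λ i i<n → e (suc i) (s<s i<n))

sumTo-mono : ∀ n {g g' : ℕ → ℕ} → (∀ i → i < n → g i ≤ g' i) → sumTo n g ≤ sumTo n g'
sumTo-mono zero e = z≤n
sumTo-mono (suc n) e = +-mono-≤ (e 0 z<s) (sumTo-mono n λ i i<n → e (suc i) (s<s i<n))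

sumTo-+ : ∀ n (g g' : ℕ → ℕ) → sumTo n (λ i → g i + g' i) ≡ sumTo n g + sumTo n g'
sumTo-+ zero g g' = refl
sumTo-+ (suc n) g g' rewrite sumTo-+ n (g ∘ suc) (g' ∘ suc) = exchange (g 0) (g' 0) _ _
  where
  exchange : ∀ a b c d → a + b + (c + d) ≡ a + c + (b + d)
  exchange = solve-∀

sumTo-zero : ∀ n (g : ℕ → ℕ) → (∀ i → i < n → g i ≡ 0) → sumTo n g ≡ 0
sumTo-zero n g e = trans (sumTo-cong n e) (zeros n)
  where
  zeros : ∀ n → sumTo n (λ _ → 0) ≡ 0
  zeros zero = refl
  zeros (suc n) = zeros n

sumTo-delta : ∀ n (g : ℕ → ℕ) c → c < n → (∀ i → i < n → i ≢ c → g i ≡ 0) → sumTo n g ≡ g c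
sumTo-delta (suc n) g zero _ e =
  trans (cong (g 0 +_) (sumTo-zero n _ λ i i<n → e (suc i) (s<s i<n) λ ())) (+-identityʳ _)
sumTo-delta (suc n) g (suc c) (s<s c<n) e =
  trans (cong (_+ sumTo n (g ∘ suc)) (e 0 z<s λ ()))
        (sumTo-delta n (g ∘ suc) c c<n λ i i<n i≢c → e (suc i) (s<s i<n) (i≢c ∘ suc-injective))

sumTo-truncate : ∀ m n {g : ℕ → ℕ} → m ≤ n → (∀ i → m ≤ i → i < n → g i ≡ 0) → sumTo n g ≡ sumTo m g
sumTo-truncate zero n z≤n e = sumTo-zero n _ λ i → e i z≤n
sumTo-truncate (suc m) (suc n) {g} (s≤s m≤n) e =
  cong (g 0 +_) (sumTo-truncate m n m≤n λ i m≤i i<n → e (suc i) (s≤s m≤i) (s<s i<n))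

sumTo-swap : ∀ n m (g : ℕ → ℕ → ℕ) → sumTo n (λ i → sumTo m (g i)) ≡ sumTo m (λ j → sumTo n (λ i → g i j))
sumTo-swap zero m g = sym (sumTo-zero m (λ _ → 0) λ _ _ → refl)
sumTo-swap (suc n) m g = begin
    sumTo m (g 0) + sumTo n (λ i → sumTo m (g (suc i)))
      ≡⟨ cong (sumTo m (g 0) +_) (sumTo-swap n m (g ∘ suc)) ⟩
    sumTo m (g 0) + sumTo m (λ j → sumTo n (λ i → g (suc i) j))
      ≡⟨ sym (sumTo-+ m (g 0) (λ j → sumTo n (λ i → g (suc i) j))) ⟩
    sumTo m (λ j → g 0 j + sumTo n (λ i → g (suc i) j)) ∎
  where open ≡-Reasoning

Pointwise : ℕ → ℕ → ℕ → (ℕ → ℕ → ℕ → Set) → Set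
Pointwise b k h P = ∀ i j l → i ≤ b → j ≤ k → l ≤ h → P i j l

sumBox : ℕ → ℕ → ℕ → (ℕ → ℕ → ℕ → ℕ) → ℕ
sumBox b k h F = sumTo (suc b) λ i → sumTo (suc k) λ j → sumTo (suc h) (F i j)

sumBox-cong : ∀ b k h {F G} → Pointwise b k h (λ i j l → F i j l ≡ G i j l) → sumBox b k h F ≡ sumBox b k h G
sumBox-cong b k h e = sumTo-cong (suc b) λ i i≤b → sumTo-cong (suc k) λ j j≤k → sumTo-cong (suc h) λ l l≤h →
  e i j l (≤-pred i≤b) (≤-pred j≤k) (≤-pred l≤h)

sumBox-mono : ∀ b k h {F G} → Pointwise b k h (λ i j l → F i j l ≤ G i j l) → sumBox b k h F ≤ sumBox b k h G
sumBox-mono b k h e = sumTo-mono (suc b) λ i i≤b → sumTo-mono (suc k) λ j j≤k → sumTo-mono (suc h) λ l l≤h →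
  e i j l (≤-pred i≤b) (≤-pred j≤k) (≤-pred l≤h)

sumBox-+ : ∀ b k h F G → sumBox b k h (λ i j l → F i j l + G i j l) ≡ sumBox b k h F + sumBox b k h G
sumBox-+ b k h F G =
  trans (sumTo-cong (suc b) λ i _ →
           trans (sumTo-cong (suc k) λ j _ → sumTo-+ (suc h) (F i j) (G i j))
                 (sumTo-+ (suc k) (λ j → sumTo (suc h) (F i j)) (λ j → sumTo (suc h) (G i j))))
        (sumTo-+ (suc b) (λ i → sumTo (suc k) λ j → sumTo (suc h) (F i j)) (λ i → sumTo (suc k) λ j → sumTo (suc h) (G i j)))

volume-cong : ∀ b k h {f g} → Pointwise b k h (λ i j l → f i j l ≡ g i j l) → volume b k h f ≡ volume b k h g
volume-cong b k h e = sumBox-cong b k h λ i j l i≤b j≤k l≤h → cong boolToℕ (e i j l i≤b j≤k l≤h)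

volume-mono : ∀ b k h {f g} → Pointwise b k h (λ i j l → f i j l ≡ true → g i j l ≡ true) → volume b k h f ≤ volume b k h g
volume-mono b k h e = sumBox-mono b k h λ i j l i≤b j≤k l≤h → boolToℕ-mono (e i j l i≤b j≤k l≤h)
  where
  boolToℕ-mono : ∀ {x y} → (x ≡ true → y ≡ true) → boolToℕ x ≤ boolToℕ y
  boolToℕ-mono {false} _ = z≤n
  boolToℕ-mono {true} x⇒y rewrite x⇒y refl = ≤-refl

volume-split : ∀ b k h f g g' → Pointwise b k h (λ i j l → boolToℕ (f i j l) ≡ boolToℕ (g i j l) + boolToℕ (g' i j l))
  → volume b k h f ≡ volume b k h g + volume b k h g'
volume-split b k h f g g' e =
  trans (sumBox-cong b k h e) (sumBox-+ b k h (λ i j l → boolToℕ (g i j l)) (λ i j l → boolToℕ (g' i j l)))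

volume-⊆ : ∀ b k h f g → f ⊆ g → volume b k h f ≤ volume b k h g
volume-⊆ b k h f g f⊆g = volume-mono b k h λ i j l _ _ _ → f⊆g (i , j , l)

volume-⁅⁆ : ∀ b k h c → InBox b k h c → volume b k h ⁅ c ⁆ ≡ 1
volume-⁅⁆ b k h c@(x , y , z) (x≤b , y≤k , z≤h) =
  trans (sumTo-delta (suc b) plane x (s≤s x≤b) λ i _ i≢x →
           sumTo-zero (suc k) (row i) λ j _ → sumTo-zero (suc h) (cell i j) λ l _ → elsewhere i j l (i≢x ∘ cong ci))
  (trans (sumTo-delta (suc k) (row x) y (s≤s y≤k) λ j _ j≢y →
            sumTo-zero (suc h) (cell x j) λ l _ → elsewhere x j l (j≢y ∘ cong cj))
  (trans (sumTo-delta (suc h) (cell x y) z (s≤s z≤h) λ l _ l≢z → elsewhere x y l (l≢z ∘ cong cl))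
         (cong boolToℕ (∋⁅⁆ c))))
  where
  cell : ℕ → ℕ → ℕ → ℕ
  cell i j l = boolToℕ (⁅ c ⁆ i j l)
  row : ℕ → ℕ → ℕ
  row i j = sumTo (suc h) (cell i j)
  plane : ℕ → ℕ
  plane i = sumTo (suc k) (row i)
  elsewhere : ∀ i j l → (i , j , l) ≢ c → cell i j l ≡ 0
  elsewhere i j l d≢c = cong boolToℕ (∉⁅⁆ c (i , j , l) d≢c)

volume-∪⁅⁆ : ∀ b k h T c → InBox b k h c → T ∌ c → volume b k h (T ∪ ⁅ c ⁆) ≡ suc (volume b k h T)
volume-∪⁅⁆ b k h T c c∈box T∌c =
  trans (volume-split b k h (T ∪ ⁅ c ⁆) ⁅ c ⁆ T λ i j l _ _ _ → pointwise i j l)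
        (cong (_+ volume b k h T) (volume-⁅⁆ b k h c c∈box))
  where
  pointwise : ∀ i j l → boolToℕ ((T ∪ ⁅ c ⁆) i j l) ≡ boolToℕ (⁅ c ⁆ i j l) + boolToℕ (T i j l)
  pointwise i j l with ⁅ c ⁆ i j l in ∋d
  ... | true with refl ← ∈⁅⁆⇒≡ c (i , j , l) ∋d rewrite T∌c = refl
  ... | false with T i j l
  ...   | true = refl
  ...   | false = refl

volume-within : ∀ b k h b' k' h' f → b' ≤ b → k' ≤ k → h' ≤ h → Within b' k' h' f
  → volume b k h f ≡ volume b' k' h' f
volume-within b k h b' k' h' f b'≤b k'≤k h'≤h within =
  trans (sumTo-truncate (suc b') (suc b) (s≤s b'≤b) λ i b'<i _ →
           sumTo-zero (suc k) _ λ j _ → sumTo-zero (suc h) _ λ l _ → outside i j l λ m → <⇒≱ b'<i (proj₁ (within _ m)))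
  (sumTo-cong (suc b') λ i _ →
    trans (sumTo-truncate (suc k') (suc k) (s≤s k'≤k) λ j k'<j _ →
             sumTo-zero (suc h) _ λ l _ → outside i j l λ m → <⇒≱ k'<j (proj₁ (proj₂ (within _ m))))
    (sumTo-cong (suc k') λ j _ →
      sumTo-truncate (suc h') (suc h) (s≤s h'≤h) λ l h'<l _ →
             outside i j l λ m → <⇒≱ h'<l (proj₂ (proj₂ (within _ m)))))
  where
  outside : ∀ i j l → ¬ f ∋ (i , j , l) → boolToℕ (f i j l) ≡ 0
  outside i j l ∉f = cong boolToℕ (¬∋⇒∌ f (i , j , l) ∉f)

shift₁ : Shape → Shape
shift₁ f zero j l = false
shift₁ f (suc i) j l = f i j l

volume-shift₁ : ∀ b k h f → volume (suc b) k h (shift₁ f) ≡ volume b k h f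
volume-shift₁ b k h f = cong (_+ volume b k h f) (sumTo-zero (suc k) _ λ j _ → sumTo-zero (suc h) _ λ l _ → refl)

rotate : Shape → Shape
rotate f i j l = f l i j

rotatePoint : Point → Point
rotatePoint c = cj c , cl c , ci c

volume-rotate : ∀ b k h f → volume k h b (rotate f) ≡ volume b k h f
volume-rotate b k h f =
  trans (sumTo-cong (suc k) λ j _ → sumTo-swap (suc h) (suc b) λ l i → boolToℕ (f i j l))
        (sumTo-swap (suc k) (suc b) λ j i → sumTo (suc h) λ l → boolToℕ (f i j l))

Adj-rotate : ∀ {c d} → Adj c d → Adj (rotatePoint c) (rotatePoint d)
Adj-rotate (inj₁ (di , ej , el)) = inj₂ (inj₂ (ej , el , di))
Adj-rotate (inj₂ (inj₁ (ei , dj , el))) = inj₁ (dj , el , ei)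
Adj-rotate (inj₂ (inj₂ (ei , ej , dl))) = inj₂ (inj₁ (ej , dl , ei))

within-∌ : ∀ {b k h f} → Within b k h f → ∀ c → ¬ InBox b k h c → f ∌ c
within-∌ {f = f} within c ∉box = ¬∋⇒∌ f c (∉box ∘ within c)

both-∌ : ∀ {b k h f g c} → Within b k h f → Within b k h g → ¬ InBox b k h c → f (ci c) (cj c) (cl c) ≡ g (ci c) (cj c) (cl c)
both-∌ f-within g-within ∉box = trans (within-∌ f-within _ ∉box) (sym (within-∌ g-within _ ∉box))

within-≗ : ∀ {b k h f g} → Within b k h f → Within b k h g → Pointwise b k h (λ i j l → f i j l ≡ g i j l)
  → ∀ i j l → f i j l ≡ g i j l
within-≗ {b} {k} {h} {f} {g} f-within g-within inside i j l with i ≤? b | j ≤? k | l ≤? h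
... | yes i≤b | yes j≤k | yes l≤h = inside i j l i≤b j≤k l≤h
... | no i≰b | _ | _ = both-∌ f-within g-within (i≰b ∘ proj₁)
... | yes _ | no j≰k | _ = both-∌ f-within g-within (j≰k ∘ proj₁ ∘ proj₂)
... | yes _ | yes _ | no l≰h = both-∌ f-within g-within (l≰h ∘ proj₂ ∘ proj₂)

searchBox : ∀ b k h {P : Point → Set} → (∀ c → Dec (P c)) → Dec (Σ Point λ c → InBox b k h c × P c)
searchBox b k h P? with anyUpTo? (λ i → anyUpTo? (λ j → anyUpTo? (λ l → P? (i , j , l)) (suc h)) (suc k)) (suc b)
... | yes (i , i≤b , j , j≤k , l , l≤h , p) = yes ((i , j , l) , (≤-pred i≤b , ≤-pred j≤k , ≤-pred l≤h) , p)
... | no none = no λ ((i , j , l) , (i≤b , j≤k , l≤h) , p) → none (i , s≤s i≤b , j , s≤s j≤k , l , s≤s l≤h , p)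

ClosedIn : Shape → Shape → Set
ClosedIn X T = ∀ c d → T ∋ d → X ∋ c → Adj d c → T ∋ c

-- Within a finite shape X, a subset T grown one adjacent cell at a time ends up closed under
-- adjacency in X; an invariant preserved by each such step holds of the result.
module Growth (b k h : ℕ) (X : Shape) (X-within : Within b k h X) where

  GrowthStep : (Shape → Set) → Set
  GrowthStep Inv = ∀ T c d → T ⊆ X → X ∋ c → T ∋ d → T ∌ c → Adj d c → Inv T → Inv (T ∪ ⁅ c ⁆)

  private
    Frontier : Shape → Point → Set
    Frontier T c = X ∋ c × T ∌ c × Σ Point λ d → InBox b k h d × T ∋ d × Adj d c

    frontier? : ∀ T c → Dec (Frontier T c)
    frontier? T c = (X ∋? c) ×-dec (T ∌? c) ×-dec searchBox b k h (λ d → (T ∋? d) ×-dec Adj? d c)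

    ∪⁅⁆⊆ : ∀ {T c} → T ⊆ X → X ∋ c → (T ∪ ⁅ c ⁆) ⊆ X
    ∪⁅⁆⊆ {T} {c} T⊆X X∋c d ∋d with ∪-elim T ⁅ c ⁆ d ∋d
    ... | inj₁ T∋d = T⊆X d T∋d
    ... | inj₂ ∋c with refl ← ∈⁅⁆⇒≡ c d ∋c = X∋c

  -- The fuel m bounds the number of cells of X still missing from T.
  grow-from : ∀ {Inv} → GrowthStep Inv → ∀ m T → T ⊆ X → volume b k h X ≤ volume b k h T + m → Inv T
    → Σ Shape λ T' → T' ⊆ X × Inv T' × ClosedIn X T' × T ⊆ T'
  grow-from {Inv} step m T T⊆X fuel inv with searchBox b k h (frontier? T)
  ... | no none = T , T⊆X , inv , closed , λ _ ∋c → ∋c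
    where
    closed : ClosedIn X T
    closed c d T∋d X∋c adj with ∋⊎∌ T c
    ... | inj₁ T∋c = T∋c
    ... | inj₂ T∌c = ⊥-elim (none (c , X-within c X∋c , X∋c , T∌c , d , X-within d (T⊆X d T∋d) , T∋d , adj))
  ... | yes (c , c∈box , X∋c , T∌c , d , _ , T∋d , adj) with m
  ...   | zero = ⊥-elim (<⇒≱ T<X (subst (volume b k h X ≤_) (+-identityʳ _) fuel))
    where
    T<X : volume b k h T < volume b k h X
    T<X = subst (_≤ volume b k h X) (volume-∪⁅⁆ b k h T c c∈box T∌c) (volume-⊆ b k h _ X (∪⁅⁆⊆ T⊆X X∋c))
  ...   | suc m with grow-from step m (T ∪ ⁅ c ⁆) (∪⁅⁆⊆ T⊆X X∋c) fuel' (step T c d T⊆X X∋c T∋d T∌c adj inv)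
    where
    fuel' : volume b k h X ≤ volume b k h (T ∪ ⁅ c ⁆) + m
    fuel' = subst (volume b k h X ≤_) (trans (+-suc _ m) (cong (_+ m) (sym (volume-∪⁅⁆ b k h T c c∈box T∌c)))) fuel
  ... | T' , T'⊆X , inv' , closed , ⊆T' = T' , T'⊆X , inv' , closed , λ d ∋d → ⊆T' d (∪-introˡ T ⁅ c ⁆ d ∋d)

  grow : ∀ {Inv} → GrowthStep Inv → ∀ x → X ∋ x → Inv ⁅ x ⁆
    → Σ Shape λ T → T ⊆ X × Inv T × ClosedIn X T × T ∋ x
  grow step x X∋x inv with grow-from step (volume b k h X) ⁅ x ⁆ ⁅x⁆⊆X (m≤n+m (volume b k h X) (volume b k h ⁅ x ⁆)) inv
    where
    ⁅x⁆⊆X : ⁅ x ⁆ ⊆ X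
    ⁅x⁆⊆X c ∋c with refl ← ∈⁅⁆⇒≡ x c ∋c = X∋x
  ... | T , T⊆X , inv' , closed , ⁅x⁆⊆T = T , T⊆X , inv' , closed , ⁅x⁆⊆T x (∋⁅⁆ x)

  closed-absorbs : ∀ {T} → ClosedIn X T → ∀ {c d} → T ∋ c → Path X c d → T ∋ d
  closed-absorbs closed T∋c ε = T∋c
  closed-absorbs closed T∋c ((_ , X∋e , adj) ◅ p) = closed-absorbs closed (closed _ _ T∋c X∋e adj) p

  closed-path : ∀ {T} → ClosedIn X T → ∀ {c d} → T ∋ c → Path X c d → Path T c d
  closed-path closed T∋c ε = ε
  closed-path closed T∋c ((_ , X∋e , adj) ◅ p) =
    (T∋c , closed _ _ T∋c X∋e adj , adj) ◅ closed-path closed (closed _ _ T∋c X∋e adj) p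

spread : Point → Point → Point → Point → Point → Point → ℕ
spread p q r s u v = ∣ ci p - ci q ∣ + ∣ cj r - cj s ∣ + ∣ cl u - cl v ∣

ExtentBound : ℕ → ℕ → ℕ → Shape → Set
ExtentBound b k h T = ∀ p q r s u v → T ∋ p → T ∋ q → T ∋ r → T ∋ s → T ∋ u → T ∋ v
  → suc (spread p q r s u v) ≤ volume b k h T

∣suc-n∣ : ∀ n → ∣ suc n - n ∣ ≡ 1
∣suc-n∣ zero = refl
∣suc-n∣ (suc n) = ∣suc-n∣ n

Differ-dist : ∀ {x y} → Differ x y → ∣ x - y ∣ ≡ 1
Differ-dist {y = y} (inj₁ refl) = ∣suc-n∣ y
Differ-dist {x = x} (inj₂ refl) = trans (∣-∣-comm x (suc x)) (∣suc-n∣ x)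

≡-dist : ∀ {x y} → x ≡ y → ∣ x - y ∣ ≡ 0
≡-dist {x} refl = ∣n-n∣≡0 x

Adj-dist : ∀ {d c} → Adj d c → ∣ ci c - ci d ∣ + ∣ cj c - cj d ∣ + ∣ cl c - cl d ∣ ≡ 1
Adj-dist {d} {c} (inj₁ (di , ej , el))
  rewrite ∣-∣-comm (ci c) (ci d) | Differ-dist di | ≡-dist (sym ej) | ≡-dist (sym el) = refl
Adj-dist {d} {c} (inj₂ (inj₁ (ei , dj , el)))
  rewrite ≡-dist (sym ei) | ∣-∣-comm (cj c) (cj d) | Differ-dist dj | ≡-dist (sym el) = refl
Adj-dist {d} {c} (inj₂ (inj₂ (ei , ej , dl)))
  rewrite ≡-dist (sym ei) | ≡-dist (sym ej) | ∣-∣-comm (cl c) (cl d) | Differ-dist dl = refl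

-- Every cell of T ∪ ⁅ c ⁆ is represented by a cell of T: itself, or d in place of c.
module Representative (T : Shape) (c d : Point) (T∋d : T ∋ d) where

  Rep : Point → Point → Set
  Rep x x' = (x ≡ x' × T ∋ x) ⊎ (x ≡ c × x' ≡ d)

  rep : ∀ x → (T ∪ ⁅ c ⁆) ∋ x → Σ Point λ x' → Rep x x' × T ∋ x'
  rep x ∋x with ∋⊎∌ T x | ∪-elim T ⁅ c ⁆ x ∋x
  ... | inj₁ T∋x | _ = x , inj₁ (refl , T∋x) , T∋x
  ... | inj₂ T∌x | inj₁ T∋x = ⊥-elim (∌⇒¬∋ T x T∌x T∋x)
  ... | inj₂ _ | inj₂ ∋c = d , inj₂ (∈⁅⁆⇒≡ c x ∋c , refl) , T∋d

  rep-dist : ∀ (π : Point → ℕ) {x x' y y'} → Rep x x' → Rep y y' → ∣ π x - π y ∣ ≤ ∣ π x' - π y' ∣ + ∣ π c - π d ∣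
  rep-dist π {x} {y = y} (inj₁ (refl , _)) (inj₁ (refl , _)) = m≤m+n ∣ π x - π y ∣ ∣ π c - π d ∣
  rep-dist π {x} (inj₁ (refl , _)) (inj₂ (refl , refl)) =
    subst (∣ π x - π c ∣ ≤_) (cong (∣ π x - π d ∣ +_) (∣-∣-comm (π d) (π c))) (∣-∣-triangle (π x) (π d) (π c))
  rep-dist π {y = y} (inj₂ (refl , refl)) (inj₁ (refl , _)) =
    subst (∣ π c - π y ∣ ≤_) (+-comm (∣ π c - π d ∣) _) (∣-∣-triangle (π c) (π d) (π y))
  rep-dist π (inj₂ (refl , refl)) (inj₂ (refl , refl)) rewrite ∣n-n∣≡0 (π c) = z≤n

  spread-∪⁅⁆ : Adj d c → ∀ {p q r s u v} p' q' r' s' u' v'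
    → Rep p p' → Rep q q' → Rep r r' → Rep s s' → Rep u u' → Rep v v' → spread p q r s u v ≤ suc (spread p' q' r' s' u' v')
  spread-∪⁅⁆ adj {p} {q} {r} {s} {u} {v} p' q' r' s' u' v' rp rq rr rs ru rv =
    subst (spread p q r s u v ≤_)
      (trans (regroup ∣ ci p' - ci q' ∣ ∣ cj r' - cj s' ∣ ∣ cl u' - cl v' ∣ ∣ ci c - ci d ∣ ∣ cj c - cj d ∣ ∣ cl c - cl d ∣)
             (trans (cong (spread p' q' r' s' u' v' +_) (Adj-dist adj)) (+-comm _ 1)))
      (+-mono-≤ (+-mono-≤ (rep-dist ci rp rq) (rep-dist cj rr rs)) (rep-dist cl ru rv))
    where
    regroup : ∀ a b c x y z → (a + x) + (b + y) + (c + z) ≡ (a + b + c) + (x + y + z)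
    regroup = solve-∀

  spread-bound : Adj d c → ∀ V → (∀ p q r s u v → T ∋ p → T ∋ q → T ∋ r → T ∋ s → T ∋ u → T ∋ v
      → suc (spread p q r s u v) ≤ V)
    → ∀ p q r s u v → (T ∪ ⁅ c ⁆) ∋ p → (T ∪ ⁅ c ⁆) ∋ q → (T ∪ ⁅ c ⁆) ∋ r → (T ∪ ⁅ c ⁆) ∋ s
    → (T ∪ ⁅ c ⁆) ∋ u → (T ∪ ⁅ c ⁆) ∋ v → suc (spread p q r s u v) ≤ suc V
  spread-bound adj V bound p q r s u v ∋p ∋q ∋r ∋s ∋u ∋v
    with p' , rp , ∋p' ← rep p ∋p | q' , rq , ∋q' ← rep q ∋q | r' , rr , ∋r' ← rep r ∋r
       | s' , rs , ∋s' ← rep s ∋s | u' , ru , ∋u' ← rep u ∋u | v' , rv , ∋v' ← rep v ∋v =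
    s≤s (≤-trans (spread-∪⁅⁆ adj p' q' r' s' u' v' rp rq rr rs ru rv) (bound p' q' r' s' u' v' ∋p' ∋q' ∋r' ∋s' ∋u' ∋v'))

module ExtentBoundOf (b k h : ℕ) (X : Shape) (X-within : Within b k h X) where
  open Growth b k h X X-within

  extentBound-step : GrowthStep (ExtentBound b k h)
  extentBound-step T c d _ X∋c T∋d T∌c adj bound p q r s u v ∋p ∋q ∋r ∋s ∋u ∋v =
    subst (suc (spread p q r s u v) ≤_) (sym (volume-∪⁅⁆ b k h T c (X-within c X∋c) T∌c))
      (Representative.spread-bound T c d T∋d adj (volume b k h T) bound p q r s u v ∋p ∋q ∋r ∋s ∋u ∋v)

  extentBound-⁅⁆ : ∀ x → InBox b k h x → ExtentBound b k h ⁅ x ⁆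
  extentBound-⁅⁆ x x∈box p q r s u v ∋p ∋q ∋r ∋s ∋u ∋v = ≤-reflexive (begin
    suc (spread p q r s u v)
      ≡⟨ cong suc (cong₂ _+_ (cong₂ _+_ (same ci p q ∋p ∋q) (same cj r s ∋r ∋s)) (same cl u v ∋u ∋v)) ⟩
    1 ≡⟨ volume-⁅⁆ b k h x x∈box ⟨
    volume b k h ⁅ x ⁆ ∎)
    where
    open ≡-Reasoning
    same : ∀ (π : Point → ℕ) y z → ⁅ x ⁆ ∋ y → ⁅ x ⁆ ∋ z → ∣ π y - π z ∣ ≡ 0
    same π y z ∋y ∋z = trans (cong₂ (λ y z → ∣ π y - π z ∣) (∈⁅⁆⇒≡ x y ∋y) (∈⁅⁆⇒≡ x z ∋z)) (∣n-n∣≡0 (π x))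

  connected⇒extentBound : IsConnected X → ∀ {x} → X ∋ x → ExtentBound b k h X
  connected⇒extentBound connected {x} X∋x p q r s u v ∋p ∋q ∋r ∋s ∋u ∋v =
    ≤-trans (bound p q r s u v (in-T p ∋p) (in-T q ∋q) (in-T r ∋r) (in-T s ∋s) (in-T u ∋u) (in-T v ∋v))
            (volume-⊆ b k h T X T⊆X)
    where
    grown : Σ Shape λ T → T ⊆ X × ExtentBound b k h T × ClosedIn X T × T ∋ x
    grown = grow extentBound-step x X∋x (extentBound-⁅⁆ x (X-within x X∋x))
    T : Shape
    T = proj₁ grown
    T⊆X : T ⊆ X
    T⊆X = proj₁ (proj₂ grown)
    bound : ExtentBound b k h T
    bound = proj₁ (proj₂ (proj₂ grown))
    in-T : ∀ y → X ∋ y → T ∋ y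
    in-T y X∋y = closed-absorbs closed T∋x (connected x y X∋x X∋y)
      where
      closed : ClosedIn X T
      closed = proj₁ (proj₂ (proj₂ (proj₂ grown)))
      T∋x : T ∋ x
      T∋x = proj₂ (proj₂ (proj₂ (proj₂ grown)))

module Component (b k h : ℕ) (X : Shape) (X-within : Within b k h X) (x : Point) (X∋x : X ∋ x) where
  open Growth b k h X X-within

  private
    ReachedFrom : Shape → Set
    ReachedFrom T = ∀ c → T ∋ c → Path X x c

    reached-step : GrowthStep ReachedFrom
    reached-step T c d T⊆X X∋c T∋d _ adj reached e ∋e with ∪-elim T ⁅ c ⁆ e ∋e
    ... | inj₁ T∋e = reached e T∋e
    ... | inj₂ ∋c with refl ← ∈⁅⁆⇒≡ c e ∋c = reached d T∋d ◅◅ ((T⊆X d T∋d , X∋c , adj) ◅ ε)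

    reached-⁅⁆ : ReachedFrom ⁅ x ⁆
    reached-⁅⁆ c ∋c with refl ← ∈⁅⁆⇒≡ x c ∋c = ε

  abstract
    component : Σ Shape λ K → K ⊆ X × ReachedFrom K × ClosedIn X K × K ∋ x
    component = grow reached-step x X∋x reached-⁅⁆

    K : Shape
    K = proj₁ component

    K⊆X : K ⊆ X
    K⊆X = proj₁ (proj₂ component)

    K-reached : ∀ c → K ∋ c → Path X x c
    K-reached = proj₁ (proj₂ (proj₂ component))

    K-closed : ClosedIn X K
    K-closed = proj₁ (proj₂ (proj₂ (proj₂ component)))

    K∋x : K ∋ x
    K∋x = proj₂ (proj₂ (proj₂ (proj₂ component)))

  K-rooted : RootedAt K x
  K-rooted c K∋c = closed-path K-closed K∋x (K-reached c K∋c)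

  K-within : Within b k h K
  K-within c K∋c = X-within c (K⊆X c K∋c)

-- A corner polyomino of the (b+1) × (k+1) × (h+1) prism, in coordinates starting at 0.
record CornerShape (b k h : ℕ) (f : Shape) : Set where
  field
    within : Within b k h f
    ∋origin : f ∋ origin
    rooted : RootedAt f origin
    reachesI : Σ Point λ c → f ∋ c × ci c ≡ b
    reachesJ : Σ Point λ c → f ∋ c × cj c ≡ k
    reachesL : Σ Point λ c → f ∋ c × cl c ≡ h
    volume≡ : volume b k h f ≡ suc (b + k + h)

CornerShape-cong : ∀ {b k h f g} → (∀ i j l → f i j l ≡ g i j l) → CornerShape b k h f → CornerShape b k h g
CornerShape-cong {b} {k} {h} {f} {g} f≗g cs = record
  { within = λ c ∋c → within c (g⊆f c ∋c)
  ; ∋origin = f⊆g origin ∋origin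
  ; rooted = λ c ∋c → path-mono f⊆g (rooted c (g⊆f c ∋c))
  ; reachesI = transport reachesI
  ; reachesJ = transport reachesJ
  ; reachesL = transport reachesL
  ; volume≡ = trans (sym (volume-cong b k h λ i j l _ _ _ → f≗g i j l)) volume≡
  }
  where
  open CornerShape cs
  f⊆g : f ⊆ g
  f⊆g c ∋c = trans (sym (f≗g (ci c) (cj c) (cl c))) ∋c
  g⊆f : g ⊆ f
  g⊆f c ∋c = trans (f≗g (ci c) (cj c) (cl c)) ∋c
  transport : ∀ {π : Point → ℕ} {n} → (Σ Point λ c → f ∋ c × π c ≡ n) → Σ Point λ c → g ∋ c × π c ≡ n
  transport (c , ∋c , e) = c , f⊆g c ∋c , e

-- The ways of sharing an extent m between the two parts of a peeled shape: one of them gets all of it.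
splits : ℕ → List (ℕ × ℕ)
splits zero = (0 , 0) ∷ []
splits (suc m) = (suc m , 0) ∷ (0 , suc m) ∷ []

splits-all-left : ∀ m → (m , 0) ∈ splits m
splits-all-left zero = here refl
splits-all-left (suc m) = here refl

splits-all-right : ∀ m → (0 , m) ∈ splits m
splits-all-right zero = here refl
splits-all-right (suc m) = there (here refl)

splits-cases : ∀ {m x y} → (x , y) ∈ splits m → (x ≡ m × y ≡ 0) ⊎ (x ≡ 0 × y ≡ m)
splits-cases {zero} (here refl) = inj₁ (refl , refl)
splits-cases {suc m} (here refl) = inj₁ (refl , refl)
splits-cases {suc m} (there (here refl)) = inj₂ (refl , refl)

splits-sum : ∀ {m x y} → (x , y) ∈ splits m → x + y ≡ m
splits-sum s with splits-cases s
... | inj₁ (refl , refl) = +-identityʳ _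
... | inj₂ (refl , refl) = refl

splits-≤ˡ : ∀ {m x y} → (x , y) ∈ splits m → x ≤ m
splits-≤ˡ s = subst (_ ≤_) (splits-sum s) (m≤m+n _ _)

splits-≤ʳ : ∀ {m x y} → (x , y) ∈ splits m → y ≤ m
splits-≤ʳ {x = x} s = subst (_ ≤_) (splits-sum s) (m≤n+m _ x)

splits-≡ : ∀ {m x₁ y₁ x₂ y₂} → (x₁ , y₁) ∈ splits m → (x₂ , y₂) ∈ splits m → x₁ ≡ x₂
  → (x₁ , y₁) ≡ (x₂ , y₂)
splits-≡ {x₁ = x₁} s₁ s₂ refl = cong (x₁ ,_) (+-cancelˡ-≡ x₁ _ _ (trans (splits-sum s₁) (sym (splits-sum s₂))))

+-tight : ∀ {x y A B} → A ≤ x → B ≤ y → x + y ≡ A + B → x ≡ A × y ≡ B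
+-tight {x} {y} {A} {B} A≤x B≤y e with ≤-antisym (≮⇒≥ λ A<x → <⇒≢ (+-mono-<-≤ A<x B≤y) (sym e)) A≤x
... | refl = refl , +-cancelˡ-≡ A _ _ e

+³-cancel₁-≤ : ∀ {x y z p q r} → x + y + z ≤ p + q + r → y ≡ q → z ≡ r → x ≤ p
+³-cancel₁-≤ {x} {y} {z} {p} {q} {r} le refl refl =
  +-cancelʳ-≤ (q + r) x p (subst₂ _≤_ (+-assoc x q r) (+-assoc p q r) le)

+³-cancel₂-≤ : ∀ {x y z p q r} → x + y + z ≤ p + q + r → x ≡ p → z ≡ r → y ≤ q
+³-cancel₂-≤ {x} {y} {z} {p} {q} {r} le refl refl = +-cancelˡ-≤ x y q (+-cancelʳ-≤ r (x + y) (x + q) le)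

+³-cancel₃-≤ : ∀ {x y z p q r} → x + y + z ≤ p + q + r → x ≡ p → y ≡ q → z ≤ r
+³-cancel₃-≤ {x} {y} {z} {p} {q} {r} le refl refl = +-cancelˡ-≤ (x + y) z r le

Differ-pred : ∀ {x y} → x ≢ 0 → y ≢ 0 → Differ x y → Differ (pred x) (pred y)
Differ-pred _ y≢0 (inj₁ refl) = inj₁ (sym (suc-pred _ {{≢-nonZero y≢0}}))
Differ-pred x≢0 _ (inj₂ refl) = inj₂ (sym (suc-pred _ {{≢-nonZero x≢0}}))

lower : Point → Point
lower c = pred (ci c) , cj c , cl c

Adj-lower : ∀ {c d} → ci c ≢ 0 → ci d ≢ 0 → Adj c d → Adj (lower c) (lower d)
Adj-lower c≢0 d≢0 (inj₁ (di , ej , el)) = inj₁ (Differ-pred c≢0 d≢0 di , ej , el)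
Adj-lower _ _ (inj₂ (inj₁ (ei , dj , el))) = inj₂ (inj₁ (cong pred ei , dj , el))
Adj-lower _ _ (inj₂ (inj₂ (ei , ej , dl))) = inj₂ (inj₂ (cong pred ei , ej , dl))

record Peeling (a k h : ℕ) (f : Shape) : Set where
  field
    K K' L L' : ℕ
    splitK : (K , K') ∈ splits k
    splitL : (L , L') ∈ splits h
    R T : Shape
    R-corner : CornerShape 0 K' L' R
    T-corner : CornerShape a K L T
    decomposition : ∀ i j l → f i j l ≡ (R ∪ shift₁ T) i j l

-- Remove the corner and let K be the component of e1 and R the rest. Both are connected, so each has
-- at least 1 + (sum of its extents) cells; both together have 2 + a + k + h cells, while the far faces
-- force the extents to add up to at least a + k + h. All these inequalities are therefore tight.
module Peel (a k h : ℕ) (f : Shape) (cs : CornerShape (suc a) k h f) (f∋e1 : f ∋ e1) where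
  open CornerShape cs

  X : Shape
  X = f ∖ ⁅ origin ⁆

  X-within : Within (suc a) k h X
  X-within c ∋c = within c (proj₁ (∖-elim f ⁅ origin ⁆ c ∋c))

  open Component (suc a) k h X X-within e1 (∖-intro f ⁅ origin ⁆ e1 f∋e1 refl)

  K⊆f : K ⊆ f
  K⊆f c K∋c = proj₁ (∖-elim f ⁅ origin ⁆ c (K⊆X c K∋c))

  K∌origin : K ∌ origin
  K∌origin = ¬∋⇒∌ K origin λ K∋o → ∌⇒¬∋ ⁅ origin ⁆ origin (proj₂ (∖-elim f ⁅ origin ⁆ origin (K⊆X origin K∋o))) refl

  R : Shape
  R = f ∖ K

  R⊆f : R ⊆ f
  R⊆f c R∋c = proj₁ (∖-elim f K c R∋c)

  R∋origin : R ∋ origin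
  R∋origin = ∖-intro f K origin ∋origin K∌origin

  R-within : Within (suc a) k h R
  R-within c R∋c = within c (R⊆f c R∋c)

  K⊎R : ∀ c → f ∋ c → K ∋ c ⊎ R ∋ c
  K⊎R c f∋c with ∋⊎∌ K c
  ... | inj₁ K∋c = inj₁ K∋c
  ... | inj₂ K∌c = inj₂ (∖-intro f K c f∋c K∌c)

  -- A path of f from a cell of R to the corner cannot enter K, as K is closed in f minus the corner.
  R-path : ∀ {r} → R ∋ r → Path f r origin → Path R r origin
  R-path {r} R∋r p with r ≟ₚ origin
  ... | yes refl = ε
  R-path {r} R∋r ε | no r≢o = ⊥-elim (r≢o refl)
  R-path {r} R∋r (_◅_ {j = y} (_ , f∋y , adj) p) | no r≢o with y ≟ₚ origin | K⊎R y f∋y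
  ... | yes refl | _ = (R∋r , R∋origin , adj) ◅ ε
  ... | no _ | inj₂ R∋y = (R∋r , R∋y , adj) ◅ R-path R∋y p
  ... | no _ | inj₁ K∋y = ⊥-elim (∌⇒¬∋ K r (proj₂ (∖-elim f K r R∋r)) (K-closed r y K∋y X∋r (Adj-sym adj)))
    where
    X∋r : X ∋ r
    X∋r = ∖-intro f ⁅ origin ⁆ r (R⊆f r R∋r) (∉⁅⁆ origin r r≢o)

  R-rooted : RootedAt R origin
  R-rooted r R∋r = path-reverse (R-path R∋r (path-reverse (rooted r (R⊆f r R∋r))))

  volume-R+K : volume (suc a) k h R + volume (suc a) k h K ≡ suc (suc (a + k + h))
  volume-R+K = trans (sym (volume-split (suc a) k h f R K λ i j l _ _ _ → pointwise i j l)) volume≡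
    where
    pointwise : ∀ i j l → boolToℕ (f i j l) ≡ boolToℕ (R i j l) + boolToℕ (K i j l)
    pointwise i j l with K i j l in K∋c
    ... | true rewrite K⊆f (i , j , l) K∋c = refl
    ... | false with f i j l
    ...   | true = refl
    ...   | false = refl

  K-bound : ExtentBound (suc a) k h K
  K-bound = ExtentBoundOf.connected⇒extentBound (suc a) k h K K-within (rooted⇒connected K-rooted) K∋x

  R-bound : ExtentBound (suc a) k h R
  R-bound = ExtentBoundOf.connected⇒extentBound (suc a) k h R R-within (rooted⇒connected R-rooted) R∋origin

  budget : ∀ {x₁ y₁ x₂ y₂ x₃ y₃ x₁' y₁' x₂' y₂' x₃' y₃'}
    → K ∋ x₁ → K ∋ y₁ → K ∋ x₂ → K ∋ y₂ → K ∋ x₃ → K ∋ y₃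
    → R ∋ x₁' → R ∋ y₁' → R ∋ x₂' → R ∋ y₂' → R ∋ x₃' → R ∋ y₃'
    → (∣ ci x₁ - ci y₁ ∣ + ∣ ci x₁' - ci y₁' ∣) + (∣ cj x₂ - cj y₂ ∣ + ∣ cj x₂' - cj y₂' ∣)
      + (∣ cl x₃ - cl y₃ ∣ + ∣ cl x₃' - cl y₃' ∣) ≤ a + k + h
  budget {x₁} {y₁} {x₂} {y₂} {x₃} {y₃} {x₁'} {y₁'} {x₂'} {y₂'} {x₃'} {y₃'}
         ∋x₁ ∋y₁ ∋x₂ ∋y₂ ∋x₃ ∋y₃ ∋x₁' ∋y₁' ∋x₂' ∋y₂' ∋x₃' ∋y₃' =
    subst (_≤ a + k + h)
      (regroup ∣ ci x₁ - ci y₁ ∣ ∣ cj x₂ - cj y₂ ∣ ∣ cl x₃ - cl y₃ ∣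
               ∣ ci x₁' - ci y₁' ∣ ∣ cj x₂' - cj y₂' ∣ ∣ cl x₃' - cl y₃' ∣)
      (+-cancelˡ-≤ 2 _ _ (begin
        2 + (sK + sR)
          ≡⟨ cong suc (+-suc sK sR) ⟨
        suc sK + suc sR
          ≤⟨ +-mono-≤ (K-bound x₁ y₁ x₂ y₂ x₃ y₃ ∋x₁ ∋y₁ ∋x₂ ∋y₂ ∋x₃ ∋y₃)
                      (R-bound x₁' y₁' x₂' y₂' x₃' y₃' ∋x₁' ∋y₁' ∋x₂' ∋y₂' ∋x₃' ∋y₃') ⟩
        volume (suc a) k h K + volume (suc a) k h R ≡⟨ +-comm (volume (suc a) k h K) _ ⟩
        volume (suc a) k h R + volume (suc a) k h K ≡⟨ volume-R+K ⟩
        2 + (a + k + h) ∎))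
    where
    open ≤-Reasoning
    sK sR : ℕ
    sK = spread x₁ y₁ x₂ y₂ x₃ y₃
    sR = spread x₁' y₁' x₂' y₂' x₃' y₃'
    regroup : ∀ a₁ a₂ a₃ b₁ b₂ b₃ → (a₁ + a₂ + a₃) + (b₁ + b₂ + b₃) ≡ (a₁ + b₁) + (a₂ + b₂) + (a₃ + b₃)
    regroup = solve-∀

  record FarSplit (π : Point → ℕ) (m : ℕ) : Set where
    field
      mK mR : ℕ
      split : (mK , mR) ∈ splits m
      cK : Point
      K∋cK : K ∋ cK
      π-cK : π cK ≡ mK
      cR : Point
      R∋cR : R ∋ cR
      π-cR : π cR ≡ mR

  -- The cell on the far face lies in K or in R; the other part gets the trivial witness e1 or the corner.
  farSplit : ∀ (π : Point → ℕ) m → (Σ Point λ c → f ∋ c × π c ≡ m) → π e1 ≡ 0 → π origin ≡ 0 → FarSplit π m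
  farSplit π m (c , f∋c , π-c) π-e1 π-o with K⊎R c f∋c
  ... | inj₁ K∋c = record { mK = m ; mR = 0 ; split = splits-all-left m
                          ; cK = c ; K∋cK = K∋c ; π-cK = π-c ; cR = origin ; R∋cR = R∋origin ; π-cR = π-o }
  ... | inj₂ R∋c = record { mK = 0 ; mR = m ; split = splits-all-right m
                          ; cK = e1 ; K∋cK = K∋x ; π-cK = π-e1 ; cR = c ; R∋cR = R∋c ; π-cR = π-c }

  farSplit-extent : ∀ {π m} (s : FarSplit π m) → π e1 ≡ 0 → π origin ≡ 0
    → ∣ π (FarSplit.cK s) - π e1 ∣ + ∣ π (FarSplit.cR s) - π origin ∣ ≡ m
  farSplit-extent s π-e1 π-o rewrite FarSplit.π-cK s | FarSplit.π-cR s | π-e1 | π-o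
    | ∣-∣-identityʳ (FarSplit.mK s) | ∣-∣-identityʳ (FarSplit.mR s) = splits-sum (FarSplit.split s)

  SJ : FarSplit cj k
  SJ = farSplit cj k reachesJ refl refl

  SL : FarSplit cl h
  SL = farSplit cl h reachesL refl refl

  module SJ = FarSplit SJ
  module SL = FarSplit SL

  budget-i : ∀ {x y x' y'} → K ∋ x → K ∋ y → R ∋ x' → R ∋ y' → ∣ ci x - ci y ∣ + ∣ ci x' - ci y' ∣ ≤ a
  budget-i ∋x ∋y ∋x' ∋y' = +³-cancel₁-≤
    (budget ∋x ∋y SJ.K∋cK K∋x SL.K∋cK K∋x ∋x' ∋y' SJ.R∋cR R∋origin SL.R∋cR R∋origin)
    (farSplit-extent SJ refl refl) (farSplit-extent SL refl refl)

  FI : Point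
  FI = proj₁ reachesI

  ci-FI : ci FI ≡ suc a
  ci-FI = proj₂ (proj₂ reachesI)

  K∋FI : K ∋ FI
  K∋FI with K⊎R FI (proj₁ (proj₂ reachesI))
  ... | inj₁ K∋FI = K∋FI
  ... | inj₂ R∋FI = ⊥-elim (n≮n a (subst (_≤ a) (cong (λ z → ∣ z - 0 ∣) ci-FI) (budget-i K∋x K∋x R∋FI R∋origin)))

  FI-extent : ∣ ci FI - ci e1 ∣ + ∣ ci origin - ci origin ∣ ≡ a
  FI-extent rewrite ci-FI = trans (+-identityʳ _) (∣-∣-identityʳ a)

  budget-j : ∀ {x y x' y'} → K ∋ x → K ∋ y → R ∋ x' → R ∋ y' → ∣ cj x - cj y ∣ + ∣ cj x' - cj y' ∣ ≤ k
  budget-j ∋x ∋y ∋x' ∋y' = +³-cancel₂-≤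
    (budget K∋FI K∋x ∋x ∋y SL.K∋cK K∋x R∋origin R∋origin ∋x' ∋y' SL.R∋cR R∋origin)
    FI-extent (farSplit-extent SL refl refl)

  budget-l : ∀ {x y x' y'} → K ∋ x → K ∋ y → R ∋ x' → R ∋ y' → ∣ cl x - cl y ∣ + ∣ cl x' - cl y' ∣ ≤ h
  budget-l ∋x ∋y ∋x' ∋y' = +³-cancel₃-≤
    (budget K∋FI K∋x SJ.K∋cK K∋x ∋x ∋y R∋origin R∋origin SJ.R∋cR R∋origin ∋x' ∋y')
    FI-extent (farSplit-extent SJ refl refl)

  K-i≢0 : ∀ x → K ∋ x → ci x ≢ 0
  K-i≢0 x K∋x' ci≡0 = n≮n a (bound (budget-i K∋FI K∋x' R∋origin R∋origin))
    where
    bound : ∣ ci FI - ci x ∣ + ∣ ci origin - ci origin ∣ ≤ a → suc a ≤ a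
    bound le rewrite ci-FI | ci≡0 = subst (_≤ a) (+-identityʳ _) le

  R-i≡0 : ∀ x → R ∋ x → ci x ≡ 0
  R-i≡0 x R∋x = n≤0⇒n≡0 (+-cancelˡ-≤ a _ 0 (bound (budget-i K∋FI K∋x R∋x R∋origin)))
    where
    bound : ∣ ci FI - ci e1 ∣ + ∣ ci x - ci origin ∣ ≤ a → a + ci x ≤ a + 0
    bound le rewrite ci-FI | ∣-∣-identityʳ a | ∣-∣-identityʳ (ci x) = subst (a + ci x ≤_) (sym (+-identityʳ a)) le

  K-j≤ : ∀ x → K ∋ x → cj x ≤ SJ.mK
  K-j≤ x K∋x' = +-cancelʳ-≤ SJ.mR _ _ (bound (budget-j K∋x' K∋x SJ.R∋cR R∋origin))
    where
    bound : ∣ cj x - cj e1 ∣ + ∣ cj SJ.cR - cj origin ∣ ≤ k → cj x + SJ.mR ≤ SJ.mK + SJ.mR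
    bound le rewrite SJ.π-cR | ∣-∣-identityʳ (cj x) | ∣-∣-identityʳ SJ.mR = subst (cj x + SJ.mR ≤_) (sym (splits-sum SJ.split)) le

  R-j≤ : ∀ x → R ∋ x → cj x ≤ SJ.mR
  R-j≤ x R∋x = +-cancelˡ-≤ SJ.mK _ _ (bound (budget-j SJ.K∋cK K∋x R∋x R∋origin))
    where
    bound : ∣ cj SJ.cK - cj e1 ∣ + ∣ cj x - cj origin ∣ ≤ k → SJ.mK + cj x ≤ SJ.mK + SJ.mR
    bound le rewrite SJ.π-cK | ∣-∣-identityʳ (cj x) | ∣-∣-identityʳ SJ.mK = subst (SJ.mK + cj x ≤_) (sym (splits-sum SJ.split)) le

  K-l≤ : ∀ x → K ∋ x → cl x ≤ SL.mK
  K-l≤ x K∋x' = +-cancelʳ-≤ SL.mR _ _ (bound (budget-l K∋x' K∋x SL.R∋cR R∋origin))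
    where
    bound : ∣ cl x - cl e1 ∣ + ∣ cl SL.cR - cl origin ∣ ≤ h → cl x + SL.mR ≤ SL.mK + SL.mR
    bound le rewrite SL.π-cR | ∣-∣-identityʳ (cl x) | ∣-∣-identityʳ SL.mR = subst (cl x + SL.mR ≤_) (sym (splits-sum SL.split)) le

  R-l≤ : ∀ x → R ∋ x → cl x ≤ SL.mR
  R-l≤ x R∋x = +-cancelˡ-≤ SL.mK _ _ (bound (budget-l SL.K∋cK K∋x R∋x R∋origin))
    where
    bound : ∣ cl SL.cK - cl e1 ∣ + ∣ cl x - cl origin ∣ ≤ h → SL.mK + cl x ≤ SL.mK + SL.mR
    bound le rewrite SL.π-cK | ∣-∣-identityʳ (cl x) | ∣-∣-identityʳ SL.mK = subst (SL.mK + cl x ≤_) (sym (splits-sum SL.split)) le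

  volume-K-≥ : suc (a + SJ.mK + SL.mK) ≤ volume (suc a) k h K
  volume-K-≥ = subst (_≤ volume (suc a) k h K) extents (K-bound FI e1 SJ.cK e1 SL.cK e1 K∋FI K∋x SJ.K∋cK K∋x SL.K∋cK K∋x)
    where
    extents : suc (spread FI e1 SJ.cK e1 SL.cK e1) ≡ suc (a + SJ.mK + SL.mK)
    extents rewrite ci-FI | SJ.π-cK | SL.π-cK | ∣-∣-identityʳ a | ∣-∣-identityʳ SJ.mK | ∣-∣-identityʳ SL.mK = refl

  volume-R-≥ : suc (SJ.mR + SL.mR) ≤ volume (suc a) k h R
  volume-R-≥ = subst (_≤ volume (suc a) k h R) extents
    (R-bound origin origin SJ.cR origin SL.cR origin R∋origin R∋origin SJ.R∋cR R∋origin SL.R∋cR R∋origin)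
    where
    extents : suc (spread origin origin SJ.cR origin SL.cR origin) ≡ suc (SJ.mR + SL.mR)
    extents rewrite SJ.π-cR | SL.π-cR | ∣-∣-identityʳ SJ.mR | ∣-∣-identityʳ SL.mR = refl

  volume-K-R : volume (suc a) k h K ≡ suc (a + SJ.mK + SL.mK) × volume (suc a) k h R ≡ suc (SJ.mR + SL.mR)
  volume-K-R = +-tight volume-K-≥ volume-R-≥ (trans (+-comm (volume (suc a) k h K) _) (trans volume-R+K (sym total)))
    where
    regroup : ∀ a p q r s → suc (a + p + r) + suc (q + s) ≡ suc (suc (a + (p + q) + (r + s)))
    regroup = solve-∀
    total : suc (a + SJ.mK + SL.mK) + suc (SJ.mR + SL.mR) ≡ suc (suc (a + k + h))
    total = trans (regroup a SJ.mK SJ.mR SL.mK SL.mR)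
                  (cong₂ (λ u v → suc (suc (a + u + v))) (splits-sum SJ.split) (splits-sum SL.split))

  T : Shape
  T i j l = K (suc i) j l

  T∋lower : ∀ c → K ∋ c → T ∋ lower c
  T∋lower c K∋c = subst (λ z → K z (cj c) (cl c) ≡ true) (sym (suc-pred _ {{≢-nonZero (K-i≢0 c K∋c)}})) K∋c

  K≗shift₁T : ∀ i j l → K i j l ≡ shift₁ T i j l
  K≗shift₁T zero j l = ¬∋⇒∌ K (0 , j , l) λ K∋c → K-i≢0 (0 , j , l) K∋c refl
  K≗shift₁T (suc i) j l = refl

  T-within : Within a SJ.mK SL.mK T
  T-within c T∋c = ≤-pred (proj₁ (K-within (suc (ci c) , cj c , cl c) T∋c)) , K-j≤ _ T∋c , K-l≤ _ T∋c

  T-corner : CornerShape a SJ.mK SL.mK T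
  T-corner = record
    { within = T-within
    ; ∋origin = K∋x
    ; rooted = λ c T∋c → gmap lower lower-edge (K-rooted (suc (ci c) , cj c , cl c) T∋c)
    ; reachesI = lower FI , T∋lower FI K∋FI , cong pred ci-FI
    ; reachesJ = lower SJ.cK , T∋lower SJ.cK SJ.K∋cK , SJ.π-cK
    ; reachesL = lower SL.cK , T∋lower SL.cK SL.K∋cK , SL.π-cK
    ; volume≡ = begin
        volume a SJ.mK SL.mK T ≡⟨ volume-within a k h a SJ.mK SL.mK T ≤-refl (splits-≤ˡ SJ.split) (splits-≤ˡ SL.split) T-within ⟨
        volume a k h T ≡⟨ volume-shift₁ a k h T ⟨
        volume (suc a) k h (shift₁ T) ≡⟨ volume-cong (suc a) k h (λ i j l _ _ _ → K≗shift₁T i j l) ⟨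
        volume (suc a) k h K ≡⟨ proj₁ volume-K-R ⟩
        suc (a + SJ.mK + SL.mK) ∎
    }
    where
    open ≡-Reasoning
    lower-edge : ∀ {c d} → Edge K c d → Edge T (lower c) (lower d)
    lower-edge {c} {d} (K∋c , K∋d , adj) = T∋lower c K∋c , T∋lower d K∋d , Adj-lower (K-i≢0 c K∋c) (K-i≢0 d K∋d) adj

  R-within₀ : Within 0 SJ.mR SL.mR R
  R-within₀ c R∋c = ≤-reflexive (R-i≡0 c R∋c) , R-j≤ c R∋c , R-l≤ c R∋c

  R-corner : CornerShape 0 SJ.mR SL.mR R
  R-corner = record
    { within = R-within₀
    ; ∋origin = R∋origin
    ; rooted = R-rooted
    ; reachesI = origin , R∋origin , refl
    ; reachesJ = SJ.cR , SJ.R∋cR , SJ.π-cR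
    ; reachesL = SL.cR , SL.R∋cR , SL.π-cR
    ; volume≡ = trans (sym (volume-within (suc a) k h 0 SJ.mR SL.mR R z≤n (splits-≤ʳ SJ.split) (splits-≤ʳ SL.split) R-within₀))
                      (proj₂ volume-K-R)
    }

  f≗R∪shift₁T : ∀ i j l → f i j l ≡ (R ∪ shift₁ T) i j l
  f≗R∪shift₁T i j l rewrite sym (K≗shift₁T i j l) with K i j l in K∋c
  ... | true rewrite K⊆f (i , j , l) K∋c = refl
  ... | false with f i j l
  ...   | true = refl
  ...   | false = refl

peel : ∀ {a k h f} → CornerShape (suc a) k h f → f ∋ e1 → Peeling a k h f
peel {a} {k} {h} {f} cs f∋e1 = record
  { splitK = SJ.split ; splitL = SL.split ; R-corner = R-corner ; T-corner = T-corner ; decomposition = f≗R∪shift₁T }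
  where open Peel a k h f cs f∋e1

raise : Point → Point
raise c = suc (ci c) , cj c , cl c

Adj-raise : ∀ {c d} → Adj c d → Adj (raise c) (raise d)
Adj-raise (inj₁ (inj₁ ei , ej , el)) = inj₁ (inj₁ (cong suc ei) , ej , el)
Adj-raise (inj₁ (inj₂ ei , ej , el)) = inj₁ (inj₂ (cong suc ei) , ej , el)
Adj-raise (inj₂ (inj₁ (ei , dj , el))) = inj₂ (inj₁ (cong suc ei , dj , el))
Adj-raise (inj₂ (inj₂ (ei , ej , dl))) = inj₂ (inj₂ (cong suc ei , ej , dl))

within₀-∌raise : ∀ {k h R} → Within 0 k h R → ∀ i j l → R (suc i) j l ≡ false
within₀-∌raise {R = R} within i j l = ¬∋⇒∌ R (suc i , j , l) λ R∋c → case (proj₁ (within _ R∋c))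
  where case : suc i ≤ 0 → ⊥
        case ()

∪shift₁-elim : ∀ R T c → (R ∪ shift₁ T) ∋ c → R ∋ c ⊎ Σ Point λ c' → T ∋ c' × c ≡ raise c'
∪shift₁-elim R T (i , j , l) ∋c with ∪-elim R (shift₁ T) (i , j , l) ∋c
... | inj₁ R∋c = inj₁ R∋c
∪shift₁-elim R T (suc i , j , l) ∋c | inj₂ T∋c = inj₂ ((i , j , l) , T∋c , refl)

module Glue {a k h K K' L L'} (splitK : (K , K') ∈ splits k) (splitL : (L , L') ∈ splits h)
            {R T} (CR : CornerShape 0 K' L' R) (CT : CornerShape a K L T) where
  module CR = CornerShape CR
  module CT = CornerShape CT

  F : Shape
  F = R ∪ shift₁ T

  F∋raise : ∀ c → T ∋ c → F ∋ raise c
  F∋raise c T∋c = ∪-introʳ R (shift₁ T) (raise c) T∋c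

  R⊆F : R ⊆ F
  R⊆F c R∋c = ∪-introˡ R (shift₁ T) c R∋c

  F-within : Within (suc a) k h F
  F-within c F∋c with ∪shift₁-elim R T c F∋c
  ... | inj₁ R∋c = let (i≤ , j≤ , l≤) = CR.within c R∋c in
                   ≤-trans i≤ z≤n , ≤-trans j≤ (splits-≤ʳ splitK) , ≤-trans l≤ (splits-≤ʳ splitL)
  ... | inj₂ (c' , T∋c' , refl) = let (i≤ , j≤ , l≤) = CT.within c' T∋c' in
                   s≤s i≤ , ≤-trans j≤ (splits-≤ˡ splitK) , ≤-trans l≤ (splits-≤ˡ splitL)

  F∋e1 : F ∋ e1
  F∋e1 = F∋raise origin CT.∋origin

  F-rooted : RootedAt F origin
  F-rooted c F∋c with ∪shift₁-elim R T c F∋c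
  ... | inj₁ R∋c = path-mono R⊆F (CR.rooted c R∋c)
  ... | inj₂ (c' , T∋c' , refl) =
    (R⊆F origin CR.∋origin , F∋e1 , inj₁ (inj₂ refl , refl , refl))
      ◅ gmap raise (λ {c} {d} (T∋c , T∋d , adj) → F∋raise c T∋c , F∋raise d T∋d , Adj-raise adj) (CT.rooted c' T∋c')

  reaches : ∀ {π : Point → ℕ} {m M M'} → (M , M') ∈ splits m → π ∘ raise ≗ π
    → (Σ Point λ c → T ∋ c × π c ≡ M) → (Σ Point λ c → R ∋ c × π c ≡ M') → Σ Point λ c → F ∋ c × π c ≡ m
  reaches split π-raise (c , T∋c , π-c) (d , R∋d , π-d) with splits-cases split
  ... | inj₁ (refl , refl) = raise c , F∋raise c T∋c , trans (π-raise c) π-c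
  ... | inj₂ (refl , refl) = d , R⊆F d R∋d , π-d

  F-volume : volume (suc a) k h F ≡ suc (suc a + k + h)
  F-volume = begin
    volume (suc a) k h F
      ≡⟨ volume-split (suc a) k h F R (shift₁ T) (λ i j l _ _ _ → pointwise i j l) ⟩
    volume (suc a) k h R + volume (suc a) k h (shift₁ T)
      ≡⟨ cong₂ _+_ (volume-within (suc a) k h 0 K' L' R z≤n (splits-≤ʳ splitK) (splits-≤ʳ splitL) CR.within)
                   (trans (volume-shift₁ a k h T) (volume-within a k h a K L T ≤-refl (splits-≤ˡ splitK) (splits-≤ˡ splitL) CT.within)) ⟩
    volume 0 K' L' R + volume a K L T
      ≡⟨ cong₂ _+_ CR.volume≡ CT.volume≡ ⟩
    suc (K' + L') + suc (a + K + L)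
      ≡⟨ regroup a K K' L L' ⟩
    suc (suc a + (K + K') + (L + L'))
      ≡⟨ cong₂ (λ u v → suc (suc a + u + v)) (splits-sum splitK) (splits-sum splitL) ⟩
    suc (suc a + k + h) ∎
    where
    open ≡-Reasoning
    regroup : ∀ a p q r s → suc (q + s) + suc (a + p + r) ≡ suc (suc a + (p + q) + (r + s))
    regroup = solve-∀
    pointwise : ∀ i j l → boolToℕ (F i j l) ≡ boolToℕ (R i j l) + boolToℕ (shift₁ T i j l)
    pointwise zero j l with R 0 j l
    ... | true = refl
    ... | false = refl
    pointwise (suc i) j l rewrite within₀-∌raise CR.within i j l = refl

  F-corner : CornerShape (suc a) k h F
  F-corner = record
    { within = F-within
    ; ∋origin = R⊆F origin CR.∋origin
    ; rooted = F-rooted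
    ; reachesI = let (c , T∋c , ci-c) = CT.reachesI in raise c , F∋raise c T∋c , cong suc ci-c
    ; reachesJ = reaches splitK (λ _ → refl) CT.reachesJ CR.reachesJ
    ; reachesL = reaches splitL (λ _ → refl) CT.reachesL CR.reachesL
    ; volume≡ = F-volume
    }

  F-face₀ : ∀ j l → F 0 j l ≡ R 0 j l
  F-face₀ j l = ∨-identityʳ (R 0 j l)

∪shift₁-∋raise : ∀ {k h R} → Within 0 k h R → ∀ T c → (R ∪ shift₁ T) ∋ raise c → T ∋ c
∪shift₁-∋raise within T c ∋c rewrite within₀-∌raise within (ci c) (cj c) (cl c) = ∋c

-- Gluing is injective in the split: the extent owned by T is read off the glued shape.
owned-extent-≤ : ∀ {k h R₁ T₁ R₂ T₂ M₁ M₂} (π : Point → ℕ) → Within 0 k h R₂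
  → (∀ i j l → (R₁ ∪ shift₁ T₁) i j l ≡ (R₂ ∪ shift₁ T₂) i j l)
  → (Σ Point λ c → T₁ ∋ c × π c ≡ M₁) → (∀ c → T₂ ∋ c → π c ≤ M₂) → M₁ ≤ M₂
owned-extent-≤ {R₁ = R₁} {T₁} {T₂ = T₂} π R₂-within glued≗ (c , T₁∋c , π-c) T₂-bound =
  subst (_≤ _) π-c (T₂-bound c (∪shift₁-∋raise R₂-within T₂ c
    (trans (sym (glued≗ (suc (ci c)) (cj c) (cl c))) (∪-introʳ R₁ (shift₁ T₁) (raise c) T₁∋c))))

-- HasCount of Defs, for predicates on any type
Card : {A : Set} → (A → Set) → ℕ → Set
Card {A} P n = Σ (List A) λ L → length L ≡ n × Unique L × (∀ x → (x ∈ L → P x) × (P x → x ∈ L))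

module _ {A : Set} where

  card-⇔ : ∀ {P Q : A → Set} {n} → (∀ x → P x → Q x) → (∀ x → Q x → P x) → Card P n → Card Q n
  card-⇔ P⇒Q Q⇒P (L , len , unique , complete) =
    L , len , unique , λ x → (P⇒Q x ∘ proj₁ (complete x)) , (proj₂ (complete x) ∘ Q⇒P x)

  card-empty : ∀ {P : A → Set} → (∀ x → ¬ P x) → Card P 0
  card-empty ¬P = [] , refl , [] , λ x → (λ ()) , (λ p → ⊥-elim (¬P x p))

  card-singleton : ∀ {P : A → Set} a → (∀ x → P x → x ≡ a) → P a → Card P 1
  card-singleton a only Pa = a ∷ [] , refl , [] ∷ [] , λ x → (λ { (here refl) → Pa }) , (λ Px → here (only x Px))

  card-⊎ : ∀ {P Q : A → Set} {n m} → Card P n → Card Q m → (∀ x → P x → Q x → ⊥) → Card (λ x → P x ⊎ Q x) (n + m)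
  card-⊎ (L₁ , len₁ , u₁ , c₁) (L₂ , len₂ , u₂ , c₂) disjoint =
    L₁ ++ L₂ , trans (length-++ L₁) (cong₂ _+_ len₁ len₂) ,
    Unique.++⁺ u₁ u₂ (λ (x∈L₁ , x∈L₂) → disjoint _ (proj₁ (c₁ _) x∈L₁) (proj₁ (c₂ _) x∈L₂)) ,
    λ x → [ inj₁ ∘ proj₁ (c₁ x) , inj₂ ∘ proj₁ (c₂ x) ]′ ∘ ∈-++⁻ L₁ ,
          [ ∈-++⁺ˡ ∘ proj₂ (c₁ x) , ∈-++⁺ʳ L₁ ∘ proj₂ (c₂ x) ]′

  card-split : ∀ {P : A → Set} (g : A → Bool) {n m}
    → Card (λ x → P x × g x ≡ true) n → Card (λ x → P x × g x ≡ false) m → Card P (n + m)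
  card-split {P} g c₁ c₂ = card-⇔ (λ x → [ proj₁ , proj₁ ]′) by-g
    (card-⊎ c₁ c₂ λ x (_ , t) (_ , f) → case (trans (sym t) f))
    where
    case : true ≢ false
    case ()
    by-g : ∀ x → P x → (P x × g x ≡ true) ⊎ (P x × g x ≡ false)
    by-g x Px with g x
    ... | true = inj₁ (Px , refl)
    ... | false = inj₂ (Px , refl)

  card-unique : ∀ {P : A → Set} {n m} → Card P n → Card P m → n ≡ m
  card-unique (L₁ , len₁ , u₁ , c₁) (L₂ , len₂ , u₂ , c₂) =
    trans (sym len₁) (trans (↭-length (∼bag⇒↭ (unique∧set⇒bag u₁ u₂ λ {x} → same x))) len₂)
    where
    same : ∀ x → (x ∈ L₁) ⇔ (x ∈ L₂)
    same x = mk⇔ (λ x∈L₁ → proj₂ (c₂ x) (proj₁ (c₁ x) x∈L₁)) (λ x∈L₂ → proj₂ (c₁ x) (proj₁ (c₂ x) x∈L₂))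

module _ {A B : Set} where

  card-image : ∀ {P : A → Set} {n} (φ : A → B) → (∀ {x y} → φ x ≡ φ y → x ≡ y) → Card P n
    → Card (λ y → Σ A λ x → P x × y ≡ φ x) n
  card-image φ injective (L , len , u , c) = map φ L , trans (length-map φ L) len , Unique.map⁺ injective u ,
    λ y → (λ y∈ → let (x , x∈L , y≡) = ∈-map⁻ φ y∈ in x , proj₁ (c x) x∈L , y≡) ,
          (λ { (x , Px , refl) → ∈-map⁺ φ (proj₂ (c x) Px) })

  length-cartesianProduct : ∀ (xs : List A) (ys : List B) → length (cartesianProduct xs ys) ≡ length xs * length ys
  length-cartesianProduct [] ys = refl
  length-cartesianProduct (x ∷ xs) ys =
    trans (length-++ (map (x ,_) ys)) (cong₂ _+_ (length-map (x ,_) ys) (length-cartesianProduct xs ys))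

  card-× : ∀ {P : A → Set} {Q : B → Set} {n m} → Card P n → Card Q m → Card (λ (z : A × B) → P (proj₁ z) × Q (proj₂ z)) (n * m)
  card-× (L₁ , len₁ , u₁ , c₁) (L₂ , len₂ , u₂ , c₂) =
    cartesianProduct L₁ L₂ , trans (length-cartesianProduct L₁ L₂) (cong₂ _*_ len₁ len₂) , Unique.cartesianProduct⁺ u₁ u₂ ,
    λ (x , y) → (λ z∈ → let (x∈ , y∈) = ∈-cartesianProduct⁻ L₁ L₂ z∈ in proj₁ (c₁ x) x∈ , proj₁ (c₂ y) y∈) ,
                (λ (Px , Qy) → ∈-cartesianProduct⁺ (proj₂ (c₁ x) Px) (proj₂ (c₂ y) Qy))

module _ {I A : Set} where

  card-Σ : ∀ (P : I → A → Set) (n : I → ℕ) (is : List I) → Unique is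
    → (∀ i i' x → i ∈ is → i' ∈ is → P i x → P i' x → i ≡ i') → (∀ i → i ∈ is → Card (P i) (n i))
    → Card (λ x → Σ I λ i → i ∈ is × P i x) (sum (map n is))
  card-Σ P n [] _ _ _ = card-empty λ { x (_ , () , _) }
  card-Σ P n (i ∷ is) (i∉is ∷ u) disjoint card =
    card-⇔ here-or-there split
      (card-⊎ (card i (here refl))
              (card-Σ P n is u (λ i i' x i∈ i'∈ → disjoint i i' x (there i∈) (there i'∈)) (λ i' i'∈ → card i' (there i'∈)))
              λ x Pix (i' , i'∈ , Pi'x) → distinct i'∈ (disjoint i i' x (here refl) (there i'∈) Pix Pi'x))
    where
    distinct : ∀ {i'} → i' ∈ is → i ≢ i'
    distinct = go i∉is
      where
      go : ∀ {zs i'} → All (i ≢_) zs → i' ∈ zs → i ≢ i'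
      go (i≢z ∷ _) (here refl) = i≢z
      go (_ ∷ i≢zs) (there i'∈) = go i≢zs i'∈
    here-or-there : ∀ x → P i x ⊎ (Σ I λ i' → i' ∈ is × P i' x) → Σ I λ i' → i' ∈ (i ∷ is) × P i' x
    here-or-there x (inj₁ Pix) = i , here refl , Pix
    here-or-there x (inj₂ (i' , i'∈ , Pi'x)) = i' , there i'∈ , Pi'x
    split : ∀ x → (Σ I λ i' → i' ∈ (i ∷ is) × P i' x) → P i x ⊎ (Σ I λ i' → i' ∈ is × P i' x)
    split x (i' , here refl , Pix) = inj₁ Pix
    split x (i' , there i'∈ , Pi'x) = inj₂ (i' , i'∈ , Pi'x)

sumBool : (Bool → ℕ) → ℕ
sumBool g = g true + g false

sumBits : (Bool → Bool → Bool → ℕ) → ℕ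
sumBits c = sumBool λ n₁ → sumBool λ n₂ → sumBool λ n₃ → c n₁ n₂ n₃

card-byBits : ∀ {A : Set} {P : A → Set} (g₁ g₂ g₃ : A → Bool) (c : Bool → Bool → Bool → ℕ)
  → (∀ n₁ n₂ n₃ → Card (λ x → P x × g₁ x ≡ n₁ × g₂ x ≡ n₂ × g₃ x ≡ n₃) (c n₁ n₂ n₃)) → Card P (sumBits c)
card-byBits {P = P} g₁ g₂ g₃ c card = card-split g₁ (by₂ true) (by₂ false)
  where
  by₃ : ∀ n₁ n₂ → Card (λ x → (P x × g₁ x ≡ n₁) × g₂ x ≡ n₂) (sumBool (c n₁ n₂))
  by₃ n₁ n₂ = card-split g₃ (reassoc (card n₁ n₂ true)) (reassoc (card n₁ n₂ false))
    where
    reassoc : ∀ {n₃ n} → Card (λ x → P x × g₁ x ≡ n₁ × g₂ x ≡ n₂ × g₃ x ≡ n₃) n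
      → Card (λ x → ((P x × g₁ x ≡ n₁) × g₂ x ≡ n₂) × g₃ x ≡ n₃) n
    reassoc = card-⇔ (λ _ (p , e₁ , e₂ , e₃) → ((p , e₁) , e₂) , e₃) (λ _ (((p , e₁) , e₂) , e₃) → p , e₁ , e₂ , e₃)
  by₂ : ∀ n₁ → Card (λ x → P x × g₁ x ≡ n₁) (sumBool λ n₂ → sumBool (c n₁ n₂))
  by₂ n₁ = card-split g₂ (by₃ n₁ true) (by₃ n₁ false)

at : ∀ {A : Set} {n} → A → Vec A n → ℕ → A
at d [] i = d
at d (x ∷ xs) zero = x
at d (x ∷ xs) (suc i) = at d xs i

module _ {A : Set} where

  at-lookup : ∀ {n} (d : A) (xs : Vec A n) (i : Fin n) → at d xs (toℕ i) ≡ lookup xs i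
  at-lookup d (x ∷ xs) fzero = refl
  at-lookup d (x ∷ xs) (fsuc i) = at-lookup d xs i

  at-tabulate : ∀ {n} (d : A) (g : ℕ → A) i → i < n → at d (tabulate {n = n} (g ∘ toℕ)) i ≡ g i
  at-tabulate {suc n} d g zero _ = refl
  at-tabulate {suc n} d g (suc i) (s<s i<n) = at-tabulate d (g ∘ suc) i i<n

  at-replicate : ∀ n (d : A) i → at d (replicate n d) i ≡ d
  at-replicate zero d i = refl
  at-replicate (suc n) d zero = refl
  at-replicate (suc n) d (suc i) = at-replicate n d i

  at-outside : ∀ {n} (d : A) (xs : Vec A n) i → n ≤ i → at d xs i ≡ d
  at-outside d [] i _ = refl
  at-outside d (x ∷ xs) (suc i) (s≤s n≤i) = at-outside d xs i n≤i

  at-injective : ∀ {n} (d : A) (xs ys : Vec A n) → (∀ i → i < n → at d xs i ≡ at d ys i) → xs ≡ ys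
  at-injective d [] [] _ = refl
  at-injective d (x ∷ xs) (y ∷ ys) e = cong₂ _∷_ (e 0 z<s) (at-injective d xs ys λ i i<n → e (suc i) (s<s i<n))

  sumVec-at : ∀ {n} (g : A → ℕ) (d : A) (xs : Vec A n) → sumVec g xs ≡ sumTo n (g ∘ at d xs)
  sumVec-at g d [] = refl
  sumVec-at g d (x ∷ xs) = cong (g x +_) (sumVec-at g d xs)

Array : ℕ → ℕ → ℕ → Set
Array b k h = CellSet (suc b) (suc k) (suc h)

⟦_⟧ : ∀ {b k h} → Array b k h → Shape
⟦ S ⟧ i j l = at false (at (replicate _ false) (at (replicate _ (replicate _ false)) S i) j) l

encode : ∀ b k h → Shape → Array b k h
encode b k h f = tabulate λ i → tabulate λ j → tabulate λ l → f (toℕ i) (toℕ j) (toℕ l)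

⟦⟧-within : ∀ {b k h} (S : Array b k h) → Within b k h ⟦ S ⟧
⟦⟧-within {b} {k} {h} S (i , j , l) ∋c with i ≤? b | j ≤? k | l ≤? h
... | yes i≤b | yes j≤k | yes l≤h = i≤b , j≤k , l≤h
... | no i≰b | _ | _ with () ← trans (sym ∋c)
      (trans (cong (λ v → at false (at (replicate _ false) v j) l) (at-outside _ S i (≰⇒> i≰b)))
      (trans (cong (λ v → at false v l) (at-replicate (suc k) _ j)) (at-replicate (suc h) false l)))
... | yes _ | no j≰k | _ with () ← trans (sym ∋c)
      (trans (cong (λ v → at false v l) (at-outside _ (at _ S i) j (≰⇒> j≰k))) (at-replicate (suc h) false l))
... | yes _ | yes _ | no l≰h with () ← trans (sym ∋c) (at-outside false (at _ (at _ S i) j) l (≰⇒> l≰h))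

⟦encode⟧ : ∀ b k h f → Within b k h f → ∀ i j l → ⟦ encode b k h f ⟧ i j l ≡ f i j l
⟦encode⟧ b k h f within = within-≗ (⟦⟧-within (encode b k h f)) within λ i j l i≤b j≤k l≤h →
  trans (cong (λ v → at false (at (replicate (suc h) false) v j) l)
              (at-tabulate (replicate (suc k) (replicate (suc h) false))
                           (λ i → tabulate λ j → tabulate λ l → f i (toℕ j) (toℕ l)) i (s≤s i≤b)))
  (trans (cong (λ v → at false v l)
               (at-tabulate (replicate (suc h) false) (λ j → tabulate λ l → f i j (toℕ l)) j (s≤s j≤k)))
         (at-tabulate false (f i j) l (s≤s l≤h)))

⟦⟧-injective : ∀ {b k h} (S S' : Array b k h) → (∀ i j l → ⟦ S ⟧ i j l ≡ ⟦ S' ⟧ i j l) → S ≡ S'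
⟦⟧-injective S S' e = at-injective _ S S' λ i _ → at-injective _ _ _ λ j _ → at-injective false _ _ λ l _ → e i j l

size≡volume : ∀ {b k h} (S : Array b k h) → size S ≡ volume b k h ⟦ S ⟧
size≡volume {b} {k} {h} S = trans (sumVec-at (sumVec (sumVec boolToℕ)) row₀ S) (sumTo-cong (suc b) λ i _ →
  trans (sumVec-at (sumVec boolToℕ) column₀ (at row₀ S i))
        (sumTo-cong (suc k) λ j _ → sumVec-at boolToℕ false (at column₀ (at row₀ S i) j)))
  where
  column₀ : Vec Bool (suc h)
  column₀ = replicate (suc h) false
  row₀ : Vec (Vec Bool (suc h)) (suc k)
  row₀ = replicate (suc k) column₀

clamp : ∀ b → ℕ → Fin (suc b)
clamp zero i = fzero
clamp (suc b) zero = fzero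
clamp (suc b) (suc i) = fsuc (clamp b i)

toℕ-clamp : ∀ b i → i ≤ b → toℕ (clamp b i) ≡ i
toℕ-clamp zero zero _ = refl
toℕ-clamp (suc b) zero _ = refl
toℕ-clamp (suc b) (suc i) (s≤s i≤b) = cong suc (toℕ-clamp b i i≤b)

clamp-toℕ : ∀ b (x : Fin (suc b)) → clamp b (toℕ x) ≡ x
clamp-toℕ zero fzero = refl
clamp-toℕ (suc b) fzero = refl
clamp-toℕ (suc b) (fsuc x) = cong fsuc (clamp-toℕ b x)

module Bridge (b k h : ℕ) (S : Array b k h) where

  toPoint : Cell (suc b) (suc k) (suc h) → Point
  toPoint (i , j , l) = toℕ i , toℕ j , toℕ l

  toCell : Point → Cell (suc b) (suc k) (suc h)
  toCell c = clamp b (ci c) , clamp k (cj c) , clamp h (cl c)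

  toPoint-toCell : ∀ c → InBox b k h c → toPoint (toCell c) ≡ c
  toPoint-toCell c (i≤ , j≤ , l≤) rewrite toℕ-clamp b (ci c) i≤ | toℕ-clamp k (cj c) j≤ | toℕ-clamp h (cl c) l≤ = refl

  toCell-toPoint : ∀ x → toCell (toPoint x) ≡ x
  toCell-toPoint (i , j , l) rewrite clamp-toℕ b i | clamp-toℕ k j | clamp-toℕ h l = refl

  lookup≡⟦⟧ : ∀ i j l → ⟦ S ⟧ (toℕ i) (toℕ j) (toℕ l) ≡ lookup (lookup (lookup S i) j) l
  lookup≡⟦⟧ i j l rewrite at-lookup (replicate (suc k) (replicate (suc h) false)) S i
                              | at-lookup (replicate (suc h) false) (lookup S i) j = at-lookup false (lookup (lookup S i) j) l

  ∈c⇒∋ : ∀ x → x ∈c S → ⟦ S ⟧ ∋ toPoint x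
  ∈c⇒∋ (i , j , l) x∈S = trans (lookup≡⟦⟧ i j l) x∈S

  ∋⇒∈c : ∀ x → ⟦ S ⟧ ∋ toPoint x → x ∈c S
  ∋⇒∈c (i , j , l) ∋x = trans (sym (lookup≡⟦⟧ i j l)) ∋x

  toPoint-toCell′ : ∀ c → ⟦ S ⟧ ∋ c → toPoint (toCell c) ≡ c
  toPoint-toCell′ c ∋c = toPoint-toCell c (⟦⟧-within S c ∋c)

  ∋⇒toCell∈c : ∀ c → ⟦ S ⟧ ∋ c → toCell c ∈c S
  ∋⇒toCell∈c c ∋c = ∋⇒∈c (toCell c) (subst (⟦ S ⟧ ∋_) (sym (toPoint-toCell′ c ∋c)) ∋c)

  Adjacent⇒Adj : ∀ x y → Adjacent x y → Adj (toPoint x) (toPoint y)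
  Adjacent⇒Adj _ _ (inj₁ (di , ej , el)) = inj₁ (di , cong toℕ ej , cong toℕ el)
  Adjacent⇒Adj _ _ (inj₂ (inj₁ (ei , dj , el))) = inj₂ (inj₁ (cong toℕ ei , dj , cong toℕ el))
  Adjacent⇒Adj _ _ (inj₂ (inj₂ (ei , ej , dl))) = inj₂ (inj₂ (cong toℕ ei , cong toℕ ej , dl))

  Adj⇒Adjacent : ∀ x y → Adj (toPoint x) (toPoint y) → Adjacent x y
  Adj⇒Adjacent _ _ (inj₁ (di , ej , el)) = inj₁ (di , toℕ-injective ej , toℕ-injective el)
  Adj⇒Adjacent _ _ (inj₂ (inj₁ (ei , dj , el))) = inj₂ (inj₁ (toℕ-injective ei , dj , toℕ-injective el))
  Adj⇒Adjacent _ _ (inj₂ (inj₂ (ei , ej , dl))) = inj₂ (inj₂ (toℕ-injective ei , toℕ-injective ej , dl))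

  path⇒Path : ∀ {x y} → Star (AdjIn S) x y → Path ⟦ S ⟧ (toPoint x) (toPoint y)
  path⇒Path = gmap toPoint λ {x} {y} (x∈S , y∈S , adj) → ∈c⇒∋ x x∈S , ∈c⇒∋ y y∈S , Adjacent⇒Adj x y adj

  Path⇒path : ∀ {c d} → Path ⟦ S ⟧ c d → Star (AdjIn S) (toCell c) (toCell d)
  Path⇒path = gmap toCell λ {c} {d} (∋c , ∋d , adj) →
    ∋⇒toCell∈c c ∋c , ∋⇒toCell∈c d ∋d ,
    Adj⇒Adjacent (toCell c) (toCell d) (subst₂ Adj (sym (toPoint-toCell′ c ∋c)) (sym (toPoint-toCell′ d ∋d)) adj)

  size-shift : suc b + suc k + suc h ∸ 2 ≡ suc (b + k + h)
  size-shift rewrite +-suc b k | +-suc (b + k) h = refl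

  isCorner⇒cornerShape : IsCornerPolyomino S → CornerShape b k h ⟦ S ⟧
  isCorner⇒cornerShape ((((_ , connected) , (_ , (xI , xI∈S , xI-i) , _ , (xJ , xJ∈S , xJ-j) , _ , (xL , xL∈S , xL-l))) , size≡) ,
                        (x₀ , x₀∈S , x₀-i , x₀-j , x₀-l)) = record
    { within = ⟦⟧-within S
    ; ∋origin = subst (⟦ S ⟧ ∋_) x₀≡origin (∈c⇒∋ x₀ x₀∈S)
    ; rooted = λ c ∋c → subst₂ (Path ⟦ S ⟧) x₀≡origin (toPoint-toCell′ c ∋c)
                          (path⇒Path (connected x₀ (toCell c) x₀∈S (∋⇒toCell∈c c ∋c)))
    ; reachesI = toPoint xI , ∈c⇒∋ xI xI∈S , xI-i
    ; reachesJ = toPoint xJ , ∈c⇒∋ xJ xJ∈S , xJ-j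
    ; reachesL = toPoint xL , ∈c⇒∋ xL xL∈S , xL-l
    ; volume≡ = trans (sym (size≡volume S)) (trans size≡ size-shift)
    }
    where
    x₀≡origin : toPoint x₀ ≡ origin
    x₀≡origin rewrite x₀-i | x₀-j | x₀-l = refl

  cornerShape⇒isCorner : CornerShape b k h ⟦ S ⟧ → IsCornerPolyomino S
  cornerShape⇒isCorner cs =
    ((((x₀ , x₀∈S) , connected) ,
      ((x₀ , x₀∈S , refl) , far reachesI′ , (x₀ , x₀∈S , refl) , far reachesJ′ , (x₀ , x₀∈S , refl) , far reachesL′)) ,
     trans (size≡volume S) (trans volume≡ (sym size-shift))) ,
    (x₀ , x₀∈S , refl , refl , refl)
    where
    open CornerShape cs
    x₀ : Cell (suc b) (suc k) (suc h)
    x₀ = fzero , fzero , fzero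
    x₀∈S : x₀ ∈c S
    x₀∈S = ∋⇒∈c x₀ ∋origin
    connected : Connected S
    connected x y x∈S y∈S = subst₂ (Star (AdjIn S)) (toCell-toPoint x) (toCell-toPoint y)
      (Path⇒path (rooted⇒connected rooted (toPoint x) (toPoint y) (∈c⇒∋ x x∈S) (∈c⇒∋ y y∈S)))
    far : ∀ {π : Cell (suc b) (suc k) (suc h) → ℕ} {n} → (Σ Point λ c → ⟦ S ⟧ ∋ c × π (toCell c) ≡ n)
      → Σ (Cell (suc b) (suc k) (suc h)) λ x → x ∈c S × π x ≡ n
    far (c , ∋c , π-c) = toCell c , ∋⇒toCell∈c c ∋c , π-c
    reachesI′ : Σ Point λ c → ⟦ S ⟧ ∋ c × toℕ (proj₁ (toCell c)) ≡ suc b ∸ 1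
    reachesI′ = let (c , ∋c , e) = reachesI in c , ∋c , trans (toℕ-clamp b (ci c) (proj₁ (⟦⟧-within S c ∋c))) e
    reachesJ′ : Σ Point λ c → ⟦ S ⟧ ∋ c × toℕ (proj₁ (proj₂ (toCell c))) ≡ suc k ∸ 1
    reachesJ′ = let (c , ∋c , e) = reachesJ in c , ∋c , trans (toℕ-clamp k (cj c) (proj₁ (proj₂ (⟦⟧-within S c ∋c)))) e
    reachesL′ : Σ Point λ c → ⟦ S ⟧ ∋ c × toℕ (proj₂ (proj₂ (toCell c))) ≡ suc h ∸ 1
    reachesL′ = let (c , ∋c , e) = reachesL in c , ∋c , trans (toℕ-clamp h (cl c) (proj₂ (proj₂ (⟦⟧-within S c ∋c)))) e

CornerShape-rotate : ∀ {b k h f} → CornerShape b k h f → CornerShape k h b (rotate f)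
CornerShape-rotate {b} {k} {h} {f} cs = record
  { within = λ c ∋c → let (i≤ , j≤ , l≤) = within (cl c , ci c , cj c) ∋c in j≤ , l≤ , i≤
  ; ∋origin = ∋origin
  ; rooted = λ c ∋c → gmap rotatePoint (λ (∋x , ∋y , adj) → ∋x , ∋y , Adj-rotate adj) (rooted (cl c , ci c , cj c) ∋c)
  ; reachesI = let (c , ∋c , e) = reachesJ in rotatePoint c , ∋c , e
  ; reachesJ = let (c , ∋c , e) = reachesL in rotatePoint c , ∋c , e
  ; reachesL = let (c , ∋c , e) = reachesI in rotatePoint c , ∋c , e
  ; volume≡ = trans (volume-rotate b k h f) (trans volume≡ (cong suc (trans (+-assoc b k h) (+-comm b (k + h)))))
  }
  where open CornerShape cs

Extensional : (Shape → Set) → Set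
Extensional P = ∀ {f g} → (∀ i j l → f i j l ≡ g i j l) → P f → P g

rotateArray : ∀ {b k h} → Array b k h → Array k h b
rotateArray {b} {k} {h} S = encode k h b (rotate ⟦ S ⟧)

⟦rotateArray⟧ : ∀ {b k h} (S : Array b k h) → ∀ i j l → ⟦ rotateArray S ⟧ i j l ≡ ⟦ S ⟧ l i j
⟦rotateArray⟧ {b} {k} {h} S = ⟦encode⟧ k h b (rotate ⟦ S ⟧) λ c ∋c →
  let (i≤ , j≤ , l≤) = ⟦⟧-within S (cl c , ci c , cj c) ∋c in j≤ , l≤ , i≤

card-rotate : ∀ {b k h n} {P Q : Shape → Set} → Extensional P → Extensional Q
  → (∀ f → P f → Q (rotate (rotate f))) → (∀ f → Q f → P (rotate f))
  → Card (λ (S : Array k h b) → P ⟦ S ⟧) n → Card (λ (S : Array b k h) → Q ⟦ S ⟧) n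
card-rotate {b} {k} {h} {P = P} {Q} P-ext Q-ext P⇒Q Q⇒P card =
  card-⇔ forth back (card-image (rotateArray ∘ rotateArray) injective card)
  where
  ⟦rotate²⟧ : ∀ {b k h} (S : Array b k h) i j l → ⟦ rotateArray (rotateArray S) ⟧ i j l ≡ ⟦ S ⟧ j l i
  ⟦rotate²⟧ S i j l = trans (⟦rotateArray⟧ (rotateArray S) i j l) (⟦rotateArray⟧ S l i j)
  injective : ∀ {S S' : Array k h b} → rotateArray (rotateArray S) ≡ rotateArray (rotateArray S') → S ≡ S'
  injective {S} {S'} e = ⟦⟧-injective S S' λ i j l →
    trans (sym (⟦rotate²⟧ S l i j)) (trans (cong (λ S → ⟦ S ⟧ l i j) e) (⟦rotate²⟧ S' l i j))
  forth : ∀ S → (Σ (Array k h b) λ S' → P ⟦ S' ⟧ × S ≡ rotateArray (rotateArray S')) → Q ⟦ S ⟧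
  forth S (S' , PS' , refl) = Q-ext (λ i j l → sym (⟦rotate²⟧ S' i j l)) (P⇒Q ⟦ S' ⟧ PS')
  back : ∀ S → Q ⟦ S ⟧ → Σ (Array k h b) λ S' → P ⟦ S' ⟧ × S ≡ rotateArray (rotateArray S')
  back S QS = rotateArray S , P-ext (λ i j l → sym (⟦rotateArray⟧ S i j l)) (Q⇒P ⟦ S ⟧ QS) ,
    ⟦⟧-injective S _ λ i j l → sym (trans (⟦rotate²⟧ (rotateArray S) i j l) (⟦rotateArray⟧ S j l i))

CornerClass : ℕ → ℕ → ℕ → Bool → Bool → Bool → Shape → Set
CornerClass b k h n₁ n₂ n₃ f = CornerShape b k h f × f 1 0 0 ≡ n₁ × f 0 1 0 ≡ n₂ × f 0 0 1 ≡ n₃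

CornerClass-ext : ∀ {b k h n₁ n₂ n₃} → Extensional (CornerClass b k h n₁ n₂ n₃)
CornerClass-ext f≗g (cs , e₁ , e₂ , e₃) =
  CornerShape-cong f≗g cs , trans (sym (f≗g 1 0 0)) e₁ , trans (sym (f≗g 0 1 0)) e₂ , trans (sym (f≗g 0 0 1)) e₃

CornerClass-rotate : ∀ {b k h n₁ n₂ n₃ f} → CornerClass b k h n₁ n₂ n₃ f → CornerClass k h b n₂ n₃ n₁ (rotate f)
CornerClass-rotate (cs , e₁ , e₂ , e₃) = CornerShape-rotate cs , e₂ , e₃ , e₁

card-rotateCorner : ∀ {b k h n} → Card (λ (S : Array k h b) → CornerShape k h b ⟦ S ⟧) n
  → Card (λ (S : Array b k h) → CornerShape b k h ⟦ S ⟧) n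
card-rotateCorner = card-rotate CornerShape-cong CornerShape-cong
  (λ _ → CornerShape-rotate ∘ CornerShape-rotate) (λ _ → CornerShape-rotate)

card-rotateClass : ∀ {b k h n₁ n₂ n₃ n} → Card (λ (S : Array k h b) → CornerClass k h b n₂ n₃ n₁ ⟦ S ⟧) n
  → Card (λ (S : Array b k h) → CornerClass b k h n₁ n₂ n₃ ⟦ S ⟧) n
card-rotateClass = card-rotate CornerClass-ext CornerClass-ext
  (λ _ → CornerClass-rotate ∘ CornerClass-rotate) (λ _ → CornerClass-rotate)

-- Without a neighbour of the corner, connectedness leaves only the corner itself.
module Isolated {b k h f} (cs : CornerClass b k h false false false f) where
  open CornerShape (proj₁ cs)

  only-origin : ∀ c → f ∋ c → c ≡ origin
  only-origin c f∋c = go (rooted c f∋c)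
    where
    go : ∀ {c} → Path f origin c → c ≡ origin
    go ε = refl
    go (_◅_ {j = y} (_ , f∋y , adj) p) with Adj-origin y adj
    ... | inj₁ refl = ⊥-elim (∌⇒¬∋ f e1 (proj₁ (proj₂ cs)) f∋y)
    ... | inj₂ (inj₁ refl) = ⊥-elim (∌⇒¬∋ f e2 (proj₁ (proj₂ (proj₂ cs))) f∋y)
    ... | inj₂ (inj₂ refl) = ⊥-elim (∌⇒¬∋ f e3 (proj₂ (proj₂ (proj₂ cs))) f∋y)

  f≗⁅origin⁆ : ∀ i j l → f i j l ≡ ⁅ origin ⁆ i j l
  f≗⁅origin⁆ i j l with ∋⊎∌ f (i , j , l) | ∋⊎∌ ⁅ origin ⁆ (i , j , l)
  ... | inj₁ ∋c | inj₁ ∋c' = trans ∋c (sym ∋c')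
  ... | inj₂ ∌c | inj₂ ∌c' = trans ∌c (sym ∌c')
  ... | inj₁ ∋c | inj₂ ∌c' =
    ⊥-elim (∌⇒¬∋ ⁅ origin ⁆ (i , j , l) ∌c' (subst (⁅ origin ⁆ ∋_) (sym (only-origin _ ∋c)) (∋⁅⁆ origin)))
  ... | inj₂ ∌c | inj₁ ∋c' = ⊥-elim (∌⇒¬∋ f (i , j , l) ∌c (subst (f ∋_) (sym (∈⁅⁆⇒≡ origin _ ∋c')) ∋origin))

  extents≡0 : b + k + h ≡ 0
  extents≡0 = suc-injective (trans (sym volume≡)
    (trans (volume-cong b k h λ i j l _ _ _ → f≗⁅origin⁆ i j l) (volume-⁅⁆ b k h origin (z≤n , z≤n , z≤n))))

⁅origin⁆-corner : CornerShape 0 0 0 ⁅ origin ⁆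
⁅origin⁆-corner = record
  { within = λ c ∋c → subst (InBox 0 0 0) (sym (∈⁅⁆⇒≡ origin c ∋c)) (z≤n , z≤n , z≤n)
  ; ∋origin = refl
  ; rooted = λ c ∋c → subst (Path ⁅ origin ⁆ origin) (sym (∈⁅⁆⇒≡ origin c ∋c)) ε
  ; reachesI = origin , refl , refl
  ; reachesJ = origin , refl , refl
  ; reachesL = origin , refl , refl
  ; volume≡ = refl
  }

isolatedCount : ℕ → ℕ → ℕ → ℕ
isolatedCount zero zero zero = 1
isolatedCount _ _ _ = 0

card-isolated : ∀ b k h → Card (λ (S : Array b k h) → CornerClass b k h false false false ⟦ S ⟧) (isolatedCount b k h)
card-isolated zero zero zero = card-singleton (encode 0 0 0 ⁅ origin ⁆)
  (λ S cs → ⟦⟧-injective S _ λ i j l → trans (Isolated.f≗⁅origin⁆ cs i j l) (sym (⟦single⟧ i j l)))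
  (CornerClass-ext (λ i j l → sym (⟦single⟧ i j l)) (⁅origin⁆-corner , refl , refl , refl))
  where
  ⟦single⟧ : ∀ i j l → ⟦ encode 0 0 0 ⁅ origin ⁆ ⟧ i j l ≡ ⁅ origin ⁆ i j l
  ⟦single⟧ = ⟦encode⟧ 0 0 0 ⁅ origin ⁆ (CornerShape.within ⁅origin⁆-corner)
card-isolated zero zero (suc h) = card-empty λ S cs → case (Isolated.extents≡0 cs)
  where case : suc h ≢ 0
        case ()
card-isolated zero (suc k) h = card-empty λ S cs → case (Isolated.extents≡0 cs)
  where case : suc (k + h) ≢ 0
        case ()
card-isolated (suc b) k h = card-empty λ S cs → case (Isolated.extents≡0 cs)
  where case : suc (b + k + h) ≢ 0
        case ()

card-flat-e1 : ∀ k h n₂ n₃ → Card (λ (S : Array 0 k h) → CornerClass 0 k h true n₂ n₃ ⟦ S ⟧) 0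
card-flat-e1 k h n₂ n₃ = card-empty λ S (cs , ∋e1 , _) → case (proj₁ (CornerShape.within cs e1 ∋e1))
  where case : ¬ 1 ≤ 0
        case ()

SplitIndex : Set
SplitIndex = (ℕ × ℕ) × (ℕ × ℕ)

splitIndices : ℕ → ℕ → List SplitIndex
splitIndices k h = cartesianProduct (splits k) (splits h)

splitTerm : (ℕ → ℕ → ℕ) → (ℕ → ℕ → ℕ) → SplitIndex → ℕ
splitTerm cR cT ((K , K') , (L , L')) = cR K' L' * cT K L

splitSum : (ℕ → ℕ → ℕ) → (ℕ → ℕ → ℕ) → ℕ → ℕ → ℕ
splitSum cR cT k h = sum (map (splitTerm cR cT) (splitIndices k h))

splits-unique : ∀ m → Unique (splits m)
splits-unique zero = [] ∷ []
splits-unique (suc m) = ((λ ()) ∷ []) ∷ [] ∷ []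

module CountThroughE1 (a k h : ℕ) (n₂ n₃ : Bool) (cR cT : ℕ → ℕ → ℕ)
  (card-R : ∀ K' L' → K' ≤ k → L' ≤ h → Card (λ (S : Array 0 K' L') → CornerClass 0 K' L' false n₂ n₃ ⟦ S ⟧) (cR K' L'))
  (card-T : ∀ K L → K ≤ k → L ≤ h → Card (λ (S : Array a K L) → CornerShape a K L ⟦ S ⟧) (cT K L)) where

  glue : ∀ {K K' L L'} → Array 0 K' L' × Array a K L → Array (suc a) k h
  glue (R , T) = encode (suc a) k h (⟦ R ⟧ ∪ shift₁ ⟦ T ⟧)

  GluedFrom : SplitIndex → Array (suc a) k h → Set
  GluedFrom ((K , K') , (L , L')) S = Σ (Array 0 K' L' × Array a K L) λ (R , T) →
     (CornerClass 0 K' L' false n₂ n₃ ⟦ R ⟧ × CornerShape a K L ⟦ T ⟧) × S ≡ glue (R , T)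

  module AtIndex {K K' L L'} (splitK : (K , K') ∈ splits k) (splitL : (L , L') ∈ splits h) where

    glued-within : ∀ (R : Array 0 K' L') (T : Array a K L) → Within (suc a) k h (⟦ R ⟧ ∪ shift₁ ⟦ T ⟧)
    glued-within R T c ∋c with ∪shift₁-elim ⟦ R ⟧ ⟦ T ⟧ c ∋c
    ... | inj₁ R∋c = let (i≤ , j≤ , l≤) = ⟦⟧-within R c R∋c in
                     ≤-trans i≤ z≤n , ≤-trans j≤ (splits-≤ʳ splitK) , ≤-trans l≤ (splits-≤ʳ splitL)
    ... | inj₂ (c' , T∋c' , refl) = let (i≤ , j≤ , l≤) = ⟦⟧-within T c' T∋c' in
                     s≤s i≤ , ≤-trans j≤ (splits-≤ˡ splitK) , ≤-trans l≤ (splits-≤ˡ splitL)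

    ⟦glue⟧ : ∀ (RT : Array 0 K' L' × Array a K L) i j l
      → ⟦ glue RT ⟧ i j l ≡ (⟦ proj₁ RT ⟧ ∪ shift₁ ⟦ proj₂ RT ⟧) i j l
    ⟦glue⟧ (R , T) = ⟦encode⟧ (suc a) k h _ (glued-within R T)

    glue-injective : ∀ {RT RT' : Array 0 K' L' × Array a K L} → glue RT ≡ glue RT' → RT ≡ RT'
    glue-injective {R₁ , T₁} {R₂ , T₂} e = cong₂ _,_ (⟦⟧-injective R₁ R₂ R≗) (⟦⟧-injective T₁ T₂ T≗)
      where
      U≗ : ∀ i j l → (⟦ R₁ ⟧ ∪ shift₁ ⟦ T₁ ⟧) i j l ≡ (⟦ R₂ ⟧ ∪ shift₁ ⟦ T₂ ⟧) i j l
      U≗ i j l = trans (sym (⟦glue⟧ (R₁ , T₁) i j l)) (trans (cong (λ S → ⟦ S ⟧ i j l) e) (⟦glue⟧ (R₂ , T₂) i j l))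
      R≗ : ∀ i j l → ⟦ R₁ ⟧ i j l ≡ ⟦ R₂ ⟧ i j l
      R≗ zero j l = trans (sym (∨-identityʳ _)) (trans (U≗ 0 j l) (∨-identityʳ _))
      R≗ (suc i) j l = trans (within₀-∌raise (⟦⟧-within R₁) i j l) (sym (within₀-∌raise (⟦⟧-within R₂) i j l))
      T≗ : ∀ i j l → ⟦ T₁ ⟧ i j l ≡ ⟦ T₂ ⟧ i j l
      T≗ i j l = trans (sym (cong (_∨ ⟦ T₁ ⟧ i j l) (within₀-∌raise (⟦⟧-within R₁) i j l)))
                 (trans (U≗ (suc i) j l) (cong (_∨ ⟦ T₂ ⟧ i j l) (within₀-∌raise (⟦⟧-within R₂) i j l)))

    card-glued : Card (GluedFrom ((K , K') , (L , L'))) (splitTerm cR cT ((K , K') , (L , L')))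
    card-glued = card-image glue glue-injective
      (card-× (card-R K' L' (splits-≤ʳ splitK) (splits-≤ʳ splitL)) (card-T K L (splits-≤ˡ splitK) (splits-≤ˡ splitL)))

    glued-class : ∀ S → GluedFrom ((K , K') , (L , L')) S → CornerClass (suc a) k h true n₂ n₃ ⟦ S ⟧
    glued-class S ((R , T) , ((CR , _ , e₂ , e₃) , CT) , refl) =
      CornerClass-ext (λ i j l → sym (⟦glue⟧ (R , T) i j l))
        (F-corner , F∋e1 , trans (F-face₀ 1 0) e₂ , trans (F-face₀ 0 1) e₃)
      where open Glue splitK splitL CR CT

  index-splits : ∀ {K K' L L'} → ((K , K') , (L , L')) ∈ splitIndices k h → (K , K') ∈ splits k × (L , L') ∈ splits h
  index-splits = ∈-cartesianProduct⁻ (splits k) (splits h)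

  glued-index-unique : ∀ x y S → x ∈ splitIndices k h → y ∈ splitIndices k h → GluedFrom x S → GluedFrom y S → x ≡ y
  glued-index-unique ((K₁ , K₁') , (L₁ , L₁')) ((K₂ , K₂') , (L₂ , L₂')) S x∈ y∈
    ((R₁ , T₁) , (_ , CT₁) , refl) ((R₂ , T₂) , (_ , CT₂) , S≡₂) =
    cong₂ _,_
      (splits-≡ sK₁ sK₂ (≤-antisym (owned-extent-≤ cj (⟦⟧-within R₂) U≗ (reachesJ CT₁) (j-bound CT₂))
                                   (owned-extent-≤ cj (⟦⟧-within R₁) U≗˘ (reachesJ CT₂) (j-bound CT₁))))
      (splits-≡ sL₁ sL₂ (≤-antisym (owned-extent-≤ cl (⟦⟧-within R₂) U≗ (reachesL CT₁) (l-bound CT₂))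
                                   (owned-extent-≤ cl (⟦⟧-within R₁) U≗˘ (reachesL CT₂) (l-bound CT₁))))
    where
    open CornerShape
    sK₁ : (K₁ , K₁') ∈ splits k
    sK₁ = proj₁ (index-splits x∈)
    sL₁ : (L₁ , L₁') ∈ splits h
    sL₁ = proj₂ (index-splits x∈)
    sK₂ : (K₂ , K₂') ∈ splits k
    sK₂ = proj₁ (index-splits y∈)
    sL₂ : (L₂ , L₂') ∈ splits h
    sL₂ = proj₂ (index-splits y∈)
    U≗ : ∀ i j l → (⟦ R₁ ⟧ ∪ shift₁ ⟦ T₁ ⟧) i j l ≡ (⟦ R₂ ⟧ ∪ shift₁ ⟦ T₂ ⟧) i j l
    U≗ i j l = trans (sym (AtIndex.⟦glue⟧ sK₁ sL₁ (R₁ , T₁) i j l))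
                     (trans (cong (λ S → ⟦ S ⟧ i j l) S≡₂) (AtIndex.⟦glue⟧ sK₂ sL₂ (R₂ , T₂) i j l))
    U≗˘ : ∀ i j l → (⟦ R₂ ⟧ ∪ shift₁ ⟦ T₂ ⟧) i j l ≡ (⟦ R₁ ⟧ ∪ shift₁ ⟦ T₁ ⟧) i j l
    U≗˘ i j l = sym (U≗ i j l)
    j-bound : ∀ {K L T} → CornerShape a K L T → ∀ c → T ∋ c → cj c ≤ K
    j-bound cs c ∋c = proj₁ (proj₂ (within cs c ∋c))
    l-bound : ∀ {K L T} → CornerShape a K L T → ∀ c → T ∋ c → cl c ≤ L
    l-bound cs c ∋c = proj₂ (proj₂ (within cs c ∋c))

  peeled-glued : ∀ S → CornerClass (suc a) k h true n₂ n₃ ⟦ S ⟧ → Σ SplitIndex λ x → x ∈ splitIndices k h × GluedFrom x S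
  peeled-glued S (cs , ∋e1 , e₂ , e₃) =
    ((K , K') , (L , L')) , ∈-cartesianProduct⁺ splitK splitL ,
    (R′ , T′) , ((CornerShape-cong (λ i j l → sym (R′≗ i j l)) R-corner , R′-e1 , R′-e2 , R′-e3) ,
     CornerShape-cong (λ i j l → sym (T′≗ i j l)) T-corner) ,
    ⟦⟧-injective S _ λ i j l → trans (decomposition i j l) (trans (U≗ i j l) (sym (AtIndex.⟦glue⟧ splitK splitL (R′ , T′) i j l)))
    where
    open Peeling (peel cs ∋e1)
    R′ : Array 0 K' L'
    R′ = encode 0 K' L' R
    T′ : Array a K L
    T′ = encode a K L T
    R′≗ : ∀ i j l → ⟦ R′ ⟧ i j l ≡ R i j l
    R′≗ = ⟦encode⟧ 0 K' L' R (CornerShape.within R-corner)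
    T′≗ : ∀ i j l → ⟦ T′ ⟧ i j l ≡ T i j l
    T′≗ = ⟦encode⟧ a K L T (CornerShape.within T-corner)
    U≗ : ∀ i j l → (R ∪ shift₁ T) i j l ≡ (⟦ R′ ⟧ ∪ shift₁ ⟦ T′ ⟧) i j l
    U≗ zero j l = cong (_∨ false) (sym (R′≗ 0 j l))
    U≗ (suc i) j l = cong₂ _∨_ (sym (R′≗ (suc i) j l)) (sym (T′≗ i j l))
    R′-e1 : ⟦ R′ ⟧ 1 0 0 ≡ false
    R′-e1 = within₀-∌raise (⟦⟧-within R′) 0 0 0
    R′-face₀ : ∀ j l → ⟦ R′ ⟧ 0 j l ≡ ⟦ S ⟧ 0 j l
    R′-face₀ j l = trans (R′≗ 0 j l) (trans (sym (∨-identityʳ (R 0 j l))) (sym (decomposition 0 j l)))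
    R′-e2 : ⟦ R′ ⟧ 0 1 0 ≡ n₂
    R′-e2 = trans (R′-face₀ 1 0) e₂
    R′-e3 : ⟦ R′ ⟧ 0 0 1 ≡ n₃
    R′-e3 = trans (R′-face₀ 0 1) e₃

  card-throughE1 : Card (λ (S : Array (suc a) k h) → CornerClass (suc a) k h true n₂ n₃ ⟦ S ⟧)
                        (splitSum cR cT k h)
  card-throughE1 = card-⇔ (λ S (x , x∈ , glued) → class x x∈ S glued) peeled-glued
    (card-Σ GluedFrom (splitTerm cR cT) (splitIndices k h)
       (Unique.cartesianProduct⁺ (splits-unique k) (splits-unique h))
       glued-index-unique
       λ { ((K , K') , (L , L')) x∈ → AtIndex.card-glued (proj₁ (index-splits x∈)) (proj₂ (index-splits x∈)) })
    where
    class : ∀ x → x ∈ splitIndices k h → ∀ S → GluedFrom x S → CornerClass (suc a) k h true n₂ n₃ ⟦ S ⟧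
    class ((K , K') , (L , L')) x∈ = AtIndex.glued-class (proj₁ (index-splits x∈)) (proj₂ (index-splits x∈))

-- One recursion on b + k + h computes every class; the fuel F only has to exceed b + k + h.
mutual
  throughE1Count : ℕ → Bool → Bool → ℕ → ℕ → ℕ → ℕ
  throughE1Count F n₂ n₃ zero k h = 0
  throughE1Count F n₂ n₃ (suc a) k h = splitSum (classCount F false n₂ n₃ 0) (cornerCount F a) k h

  classCount : ℕ → Bool → Bool → Bool → ℕ → ℕ → ℕ → ℕ
  classCount zero _ _ _ _ _ _ = 0
  classCount (suc F) true n₂ n₃ b k h = throughE1Count F n₂ n₃ b k h
  classCount (suc F) false true n₃ b k h = throughE1Count F n₃ false k h b
  classCount (suc F) false false true b k h = throughE1Count F false false h b k
  classCount (suc F) false false false b k h = isolatedCount b k h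

  cornerCount : ℕ → ℕ → ℕ → ℕ → ℕ
  cornerCount F b k h = sumBits λ n₁ n₂ n₃ → classCount F n₁ n₂ n₃ b k h

CornerArray : ∀ b k h → Array b k h → Set
CornerArray b k h S = CornerShape b k h ⟦ S ⟧

ClassArray : ∀ b k h → Bool → Bool → Bool → Array b k h → Set
ClassArray b k h n₁ n₂ n₃ S = CornerClass b k h n₁ n₂ n₃ ⟦ S ⟧

rotate-< : ∀ b k h {F} → b + k + h < F → k + h + b < F
rotate-< b k h {F} = subst (_< F) (trans (+-assoc b k h) (+-comm b (k + h)))

peel-T-< : ∀ {a k h K L F} → K ≤ k → L ≤ h → suc a + k + h < suc F → a + K + L < F
peel-T-< K≤k L≤h (s≤s bound) = <-≤-trans (s≤s (+-mono-≤ (+-monoʳ-≤ _ K≤k) L≤h)) bound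

peel-R-< : ∀ {a k h K L F} → K ≤ k → L ≤ h → suc a + k + h < suc F → 0 + K + L < F
peel-R-< {a} {k} {h} K≤k L≤h (s≤s bound) =
  <-≤-trans (s≤s (≤-trans (+-mono-≤ K≤k L≤h) (subst (k + h ≤_) (sym (+-assoc a k h)) (m≤n+m (k + h) a)))) bound

mutual
  card-throughE1 : ∀ F a k h n₂ n₃ → a + k + h < suc F → Card (ClassArray a k h true n₂ n₃) (throughE1Count F n₂ n₃ a k h)
  card-throughE1 F zero k h n₂ n₃ _ = card-flat-e1 k h n₂ n₃
  card-throughE1 F (suc a) k h n₂ n₃ bound =
    CountThroughE1.card-throughE1 a k h n₂ n₃ (classCount F false n₂ n₃ 0) (cornerCount F a)
      (λ K' L' K'≤k L'≤h → card-class F 0 K' L' false n₂ n₃ (peel-R-< K'≤k L'≤h bound))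
      (λ K L K≤k L≤h → card-corner F a K L (peel-T-< K≤k L≤h bound))

  card-class : ∀ F b k h n₁ n₂ n₃ → b + k + h < F → Card (ClassArray b k h n₁ n₂ n₃) (classCount F n₁ n₂ n₃ b k h)
  card-class (suc F) b k h true n₂ n₃ bound = card-throughE1 F b k h n₂ n₃ bound
  card-class (suc F) b k h false true n₃ bound = card-rotateClass (card-throughE1 F k h b n₃ false (rotate-< b k h bound))
  card-class (suc F) b k h false false true bound =
    card-rotateClass (card-rotateClass (card-throughE1 F h b k false false (rotate-< k h b (rotate-< b k h bound))))
  card-class (suc F) b k h false false false _ = card-isolated b k h

  card-corner : ∀ F b k h → b + k + h < F → Card (CornerArray b k h) (cornerCount F b k h)
  card-corner F b k h bound = card-byBits (λ S → ⟦ S ⟧ 1 0 0) (λ S → ⟦ S ⟧ 0 1 0) (λ S → ⟦ S ⟧ 0 0 1)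
    (λ n₁ n₂ n₃ → classCount F n₁ n₂ n₃ b k h) λ n₁ n₂ n₃ → card-class F b k h n₁ n₂ n₃ bound

corners : ℕ → ℕ → ℕ → ℕ
corners b k h = cornerCount (suc (b + k + h)) b k h

classes : Bool → Bool → Bool → ℕ → ℕ → ℕ → ℕ
classes n₁ n₂ n₃ b k h = classCount (suc (b + k + h)) n₁ n₂ n₃ b k h

card-corners : ∀ b k h → Card (CornerArray b k h) (corners b k h)
card-corners b k h = card-corner (suc (b + k + h)) b k h ≤-refl

cornerCount-fuel : ∀ F b k h → b + k + h < F → cornerCount F b k h ≡ corners b k h
cornerCount-fuel F b k h bound = card-unique (card-corner F b k h bound) (card-corners b k h)

classCount-fuel : ∀ F n₁ n₂ n₃ b k h → b + k + h < F → classCount F n₁ n₂ n₃ b k h ≡ classes n₁ n₂ n₃ b k h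
classCount-fuel F n₁ n₂ n₃ b k h bound =
  card-unique (card-class F b k h n₁ n₂ n₃ bound) (card-class (suc (b + k + h)) b k h n₁ n₂ n₃ ≤-refl)

corners-rotate : ∀ b k h → corners b k h ≡ corners k h b
corners-rotate b k h = card-unique (card-corners b k h) (card-rotateCorner (card-corners k h b))

sum-map-cong : ∀ {A : Set} (f g : A → ℕ) (xs : List A) → (∀ x → x ∈ xs → f x ≡ g x) → sum (map f xs) ≡ sum (map g xs)
sum-map-cong f g [] _ = refl
sum-map-cong f g (x ∷ xs) e = cong₂ _+_ (e x (here refl)) (sum-map-cong f g xs λ y y∈ → e y (there y∈))

sum-map-+ : ∀ {A : Set} (f g : A → ℕ) (xs : List A) → sum (map f xs) + sum (map g xs) ≡ sum (map (λ x → f x + g x) xs)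
sum-map-+ f g [] = refl
sum-map-+ f g (x ∷ xs) rewrite sym (sum-map-+ f g xs) = exchange (f x) (g x) (sum (map f xs)) (sum (map g xs))
  where
  exchange : ∀ a b c d → a + c + (b + d) ≡ a + b + (c + d)
  exchange = solve-∀

splitSum-+ : ∀ cR₁ cR₂ cT k h → splitSum cR₁ cT k h + splitSum cR₂ cT k h ≡ splitSum (λ u v → cR₁ u v + cR₂ u v) cT k h
splitSum-+ cR₁ cR₂ cT k h = trans (sum-map-+ _ _ (splitIndices k h))
  (sum-map-cong _ _ (splitIndices k h) λ { ((K , K') , (L , L')) _ → sym (*-distribʳ-+ (cT K L) (cR₁ K' L') (cR₂ K' L')) })

throughE1Count-fuel : ∀ F n₂ n₃ a k h → suc a + k + h ≤ F
  → throughE1Count F n₂ n₃ (suc a) k h ≡ splitSum (classes false n₂ n₃ 0) (corners a) k h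
throughE1Count-fuel F n₂ n₃ a k h bound = sum-map-cong _ _ (splitIndices k h) λ { ((K , K') , (L , L')) x∈ →
  let (splitK , splitL) = ∈-cartesianProduct⁻ (splits k) (splits h) x∈ in
  cong₂ _*_ (classCount-fuel F false n₂ n₃ 0 K' L' (peel-R-< (splits-≤ʳ splitK) (splits-≤ʳ splitL) (s≤s bound)))
            (cornerCount-fuel F a K L (peel-T-< (splits-≤ˡ splitK) (splits-≤ˡ splitL) (s≤s bound))) }

+-rotate : ∀ b k h → k + h + b ≡ b + k + h
+-rotate b k h = trans (+-comm (k + h) b) (sym (+-assoc b k h))

throughE1 throughE2 throughE3 : ℕ → ℕ → ℕ → ℕ
throughE1 b k h = sumBool λ n₂ → sumBool λ n₃ → classes true n₂ n₃ b k h
throughE2 b k h = sumBool λ n₃ → classes false true n₃ b k h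
throughE3 b k h = classes false false true b k h

corners-byNeighbours : ∀ b k h → corners b k h ≡ throughE1 b k h + (throughE2 b k h + (throughE3 b k h + isolatedCount b k h))
corners-byNeighbours b k h = refl

-- The neighbours e2, e3 of the corner lie in the peeled-off face, whose count sums to corners 0.
throughE1-suc : ∀ a k h → throughE1 (suc a) k h ≡ splitSum (corners 0) (corners a) k h
throughE1-suc a k h = begin
  throughE1 (suc a) k h
    ≡⟨ cong₂ _+_ (cong₂ _+_ (through true true) (through true false)) (cong₂ _+_ (through false true) (through false false)) ⟩
  (S true true + S true false) + (S false true + S false false)
    ≡⟨ cong₂ _+_ (splitSum-+ (R true true) (R true false) (corners a) k h) (splitSum-+ (R false true) (R false false) (corners a) k h) ⟩
  splitSum (λ u v → R true true u v + R true false u v) (corners a) k h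
    + splitSum (λ u v → R false true u v + R false false u v) (corners a) k h
    ≡⟨ splitSum-+ (λ u v → R true true u v + R true false u v) (λ u v → R false true u v + R false false u v) (corners a) k h ⟩
  splitSum (corners 0) (corners a) k h ∎
  where
  open ≡-Reasoning
  R : Bool → Bool → ℕ → ℕ → ℕ
  R n₂ n₃ = classes false n₂ n₃ 0
  S : Bool → Bool → ℕ
  S n₂ n₃ = splitSum (R n₂ n₃) (corners a) k h
  through : ∀ n₂ n₃ → classes true n₂ n₃ (suc a) k h ≡ S n₂ n₃
  through n₂ n₃ = throughE1Count-fuel (suc a + k + h) n₂ n₃ a k h ≤-refl

faceNoE3 : ℕ → ℕ → ℕ
faceNoE3 x y = classes false true false 0 x y + classes false false false 0 x y

throughE2-suc : ∀ b c h → throughE2 b (suc c) h ≡ splitSum faceNoE3 (corners c) h b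
throughE2-suc b c h =
  trans (cong₂ _+_ (through true) (through false)) (splitSum-+ (classes false true false 0) (classes false false false 0) (corners c) h b)
  where
  through : ∀ n₃ → classes false true n₃ b (suc c) h ≡ splitSum (classes false n₃ false 0) (corners c) h b
  through n₃ = throughE1Count-fuel (b + suc c + h) n₃ false c h b (≤-reflexive (+-rotate b (suc c) h))

throughE3-suc : ∀ b k e → throughE3 b k (suc e) ≡ splitSum (isolatedCount 0) (corners e) b k
throughE3-suc b k e = throughE1Count-fuel (b + k + suc e) false false e b k (≤-reflexive (sym (+-rotate (suc e) b k)))

splitSum-0-0 : ∀ cR cT → splitSum cR cT 0 0 ≡ cR 0 0 * cT 0 0
splitSum-0-0 cR cT = +-identityʳ _

splitSum-suc-0 : ∀ cR cT x → splitSum cR cT (suc x) 0 ≡ cR 0 0 * cT (suc x) 0 + cR (suc x) 0 * cT 0 0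
splitSum-suc-0 cR cT x = cong (cR 0 0 * cT (suc x) 0 +_) (+-identityʳ _)

splitSum-0-suc : ∀ cR cT y → splitSum cR cT 0 (suc y) ≡ cR 0 0 * cT 0 (suc y) + cR 0 (suc y) * cT 0 0
splitSum-0-suc cR cT y = cong (cR 0 0 * cT 0 (suc y) +_) (+-identityʳ _)

splitSum-suc-suc : ∀ cR cT x y → splitSum cR cT (suc x) (suc y)
  ≡ cR 0 0 * cT (suc x) (suc y) + cR 0 (suc y) * cT (suc x) 0 + cR (suc x) 0 * cT 0 (suc y) + cR (suc x) (suc y) * cT 0 0
splitSum-suc-suc cR cT x y =
  assoc (cR 0 0 * cT (suc x) (suc y)) (cR 0 (suc y) * cT (suc x) 0) (cR (suc x) 0 * cT 0 (suc y)) (cR (suc x) (suc y) * cT 0 0)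
  where
  assoc : ∀ p q r s → p + (q + (r + (s + 0))) ≡ p + q + r + s
  assoc = solve-∀

corners-line : ∀ a → corners a 0 0 ≡ 1
corners-line zero = refl
corners-line (suc a) = begin
  corners (suc a) 0 0
    ≡⟨ corners-byNeighbours (suc a) 0 0 ⟩
  throughE1 (suc a) 0 0 + (throughE2 (suc a) 0 0 + (throughE3 (suc a) 0 0 + isolatedCount (suc a) 0 0))
    ≡⟨ +-identityʳ _ ⟩
  throughE1 (suc a) 0 0            ≡⟨ throughE1-suc a 0 0 ⟩
  splitSum (corners 0) (corners a) 0 0 ≡⟨ splitSum-0-0 (corners 0) (corners a) ⟩
  1 * corners a 0 0                ≡⟨ *-identityˡ _ ⟩
  corners a 0 0                    ≡⟨ corners-line a ⟩
  1 ∎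
  where open ≡-Reasoning

corners-line₂ : ∀ x → corners 0 x 0 ≡ 1
corners-line₂ x = trans (corners-rotate 0 x 0) (corners-line x)

corners-line₃ : ∀ x → corners 0 0 x ≡ 1
corners-line₃ x = trans (sym (corners-rotate x 0 0)) (corners-line x)

faceNoE3-suc : ∀ x y → faceNoE3 (suc x) y ≡ splitSum (isolatedCount 0) (corners x) y 0
faceNoE3-suc x y = trans (+-identityʳ _) (throughE1Count-fuel (suc x + y) false false x y 0 (≤-reflexive (+-identityʳ _)))

faceNoE3-line : ∀ x → faceNoE3 (suc x) 0 ≡ 1
faceNoE3-line x = trans (faceNoE3-suc x 0) (trans (splitSum-0-0 (isolatedCount 0) (corners x)) (trans (+-identityʳ _) (corners-line x)))

faceNoE3-suc-suc : ∀ x y → faceNoE3 (suc x) (suc y) ≡ corners x (suc y) 0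
faceNoE3-suc-suc x y = begin
  faceNoE3 (suc x) (suc y)  ≡⟨ faceNoE3-suc x (suc y) ⟩
  splitSum (isolatedCount 0) (corners x) (suc y) 0  ≡⟨ splitSum-suc-0 (isolatedCount 0) (corners x) y ⟩
  1 * corners x (suc y) 0 + 0 * corners x 0 0 ≡⟨ trans (+-identityʳ _) (*-identityˡ _) ⟩
  corners x (suc y) 0 ∎
  where open ≡-Reasoning

corners-face-suc : ∀ c e → corners 0 (suc c) (suc e) ≡ 1 + corners 0 c (suc e) + corners 0 (suc c) e
corners-face-suc c e = begin
  corners 0 (suc c) (suc e)
    ≡⟨ corners-byNeighbours 0 (suc c) (suc e) ⟩
  throughE1 0 (suc c) (suc e) + (throughE2 0 (suc c) (suc e) + (throughE3 0 (suc c) (suc e) + isolatedCount 0 (suc c) (suc e)))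
    ≡⟨⟩
  throughE2 0 (suc c) (suc e) + (throughE3 0 (suc c) (suc e) + 0)
    ≡⟨ cong₂ (λ u v → u + (v + 0)) (throughE2-suc 0 c (suc e)) (throughE3-suc 0 (suc c) e) ⟩
  splitSum faceNoE3 (corners c) (suc e) 0 + (splitSum (isolatedCount 0) (corners e) 0 (suc c) + 0)
    ≡⟨ cong₂ (λ u v → u + (v + 0)) (splitSum-suc-0 faceNoE3 (corners c) e) (splitSum-0-suc (isolatedCount 0) (corners e) c) ⟩
  (1 * corners c (suc e) 0 + faceNoE3 (suc e) 0 * corners c 0 0) + ((1 * corners e 0 (suc c) + 0 * corners e 0 0) + 0)
    ≡⟨ cong₂ (λ u v → (1 * corners c (suc e) 0 + u * v) + ((1 * corners e 0 (suc c) + 0 * corners e 0 0) + 0))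
             (faceNoE3-line e) (corners-line c) ⟩
  (1 * corners c (suc e) 0 + 1 * 1) + ((1 * corners e 0 (suc c) + 0 * corners e 0 0) + 0)
    ≡⟨ simplify (corners c (suc e) 0) (corners e 0 (suc c)) (corners e 0 0) ⟩
  1 + corners c (suc e) 0 + corners e 0 (suc c)
    ≡⟨ cong₂ (λ u v → 1 + u + v) (sym (corners-rotate 0 c (suc e))) (corners-rotate e 0 (suc c)) ⟩
  1 + corners 0 c (suc e) + corners 0 (suc c) e ∎
  where
  open ≡-Reasoning
  simplify : ∀ p q r → (1 * p + 1 * 1) + ((1 * q + 0 * r) + 0) ≡ 1 + p + q
  simplify = solve-∀

throughE1-suc³ : ∀ a c e → throughE1 (suc a) (suc c) (suc e)
  ≡ corners a (suc c) (suc e) + corners a (suc c) 0 + corners a 0 (suc e) + corners 0 (suc c) (suc e)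
throughE1-suc³ a c e = begin
  throughE1 (suc a) (suc c) (suc e)
    ≡⟨ throughE1-suc a (suc c) (suc e) ⟩
  splitSum (corners 0) (corners a) (suc c) (suc e)
    ≡⟨ splitSum-suc-suc (corners 0) (corners a) c e ⟩
  1 * corners a (suc c) (suc e) + corners 0 0 (suc e) * corners a (suc c) 0
    + corners 0 (suc c) 0 * corners a 0 (suc e) + corners 0 (suc c) (suc e) * corners a 0 0
    ≡⟨ drop-lines (corners a (suc c) (suc e)) (corners a (suc c) 0) (corners a 0 (suc e)) (corners 0 (suc c) (suc e))
                  (corners-line₃ (suc e)) (corners-line₂ (suc c)) (corners-line a) ⟩
  corners a (suc c) (suc e) + corners a (suc c) 0 + corners a 0 (suc e) + corners 0 (suc c) (suc e) ∎
  where
  open ≡-Reasoning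
  drop-lines : ∀ {u v w} p q r s → u ≡ 1 → v ≡ 1 → w ≡ 1 → 1 * p + u * q + v * r + s * w ≡ p + q + r + s
  drop-lines p q r s refl refl refl = simplify p q r s
    where
    simplify : ∀ p q r s → 1 * p + 1 * q + 1 * r + s * 1 ≡ p + q + r + s
    simplify = solve-∀

throughE2-suc³ : ∀ a c e → throughE2 (suc a) (suc c) (suc e)
  ≡ corners c (suc e) (suc a) + corners c 0 (suc a) + corners e (suc a) 0
throughE2-suc³ a c e = begin
  throughE2 (suc a) (suc c) (suc e)
    ≡⟨ throughE2-suc (suc a) c (suc e) ⟩
  splitSum faceNoE3 (corners c) (suc e) (suc a)
    ≡⟨ splitSum-suc-suc faceNoE3 (corners c) e a ⟩
  1 * corners c (suc e) (suc a) + 0 * corners c (suc e) 0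
    + faceNoE3 (suc e) 0 * corners c 0 (suc a) + faceNoE3 (suc e) (suc a) * corners c 0 0
    ≡⟨ drop (corners c (suc e) (suc a)) (corners c (suc e) 0) (corners c 0 (suc a)) (corners e (suc a) 0)
            (faceNoE3-line e) (faceNoE3-suc-suc e a) (corners-line c) ⟩
  corners c (suc e) (suc a) + corners c 0 (suc a) + corners e (suc a) 0 ∎
  where
  open ≡-Reasoning
  drop : ∀ {u v w} p q r s → u ≡ 1 → v ≡ s → w ≡ 1 → 1 * p + 0 * q + u * r + v * w ≡ p + r + s
  drop p q r s refl refl refl = simplify p q r s
    where
    simplify : ∀ p q r s → 1 * p + 0 * q + 1 * r + s * 1 ≡ p + r + s
    simplify = solve-∀

throughE3-suc³ : ∀ a c e → throughE3 (suc a) (suc c) (suc e) ≡ corners e (suc a) (suc c)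
throughE3-suc³ a c e = begin
  throughE3 (suc a) (suc c) (suc e)
    ≡⟨ throughE3-suc (suc a) (suc c) e ⟩
  splitSum (isolatedCount 0) (corners e) (suc a) (suc c)
    ≡⟨ splitSum-suc-suc (isolatedCount 0) (corners e) a c ⟩
  1 * corners e (suc a) (suc c) + 0 * corners e (suc a) 0 + 0 * corners e 0 (suc c) + 0 * corners e 0 0
    ≡⟨ simplify (corners e (suc a) (suc c)) (corners e (suc a) 0) (corners e 0 (suc c)) (corners e 0 0) ⟩
  corners e (suc a) (suc c) ∎
  where
  open ≡-Reasoning
  simplify : ∀ p q r s → 1 * p + 0 * q + 0 * r + 0 * s ≡ p
  simplify = solve-∀

-- Reading the eight peeled terms back as corner counts, up to rotation, with the five flat ones grouped.
corners-suc³ : ∀ a c e → corners (suc a) (suc c) (suc e)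
  ≡ corners a (suc c) (suc e) + corners (suc a) c (suc e) + corners (suc a) (suc c) e
    + (corners 0 a (suc c) + corners 0 (suc a) c) + (corners 0 e (suc a) + corners 0 (suc e) a) + corners 0 (suc c) (suc e)
corners-suc³ a c e = begin
  corners (suc a) (suc c) (suc e)
    ≡⟨ corners-byNeighbours (suc a) (suc c) (suc e) ⟩
  throughE1 (suc a) (suc c) (suc e) + (throughE2 (suc a) (suc c) (suc e) + (throughE3 (suc a) (suc c) (suc e) + 0))
    ≡⟨ cong₂ _+_ (throughE1-suc³ a c e) (cong₂ (λ u v → u + (v + 0)) (throughE2-suc³ a c e) (throughE3-suc³ a c e)) ⟩
  (corners a (suc c) (suc e) + corners a (suc c) 0 + corners a 0 (suc e) + corners 0 (suc c) (suc e))
    + ((corners c (suc e) (suc a) + corners c 0 (suc a) + corners e (suc a) 0) + (corners e (suc a) (suc c) + 0))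
    ≡⟨ rearrange (corners a (suc c) (suc e)) (corners 0 (suc c) (suc e))
         (sym (corners-rotate 0 a (suc c))) (corners-rotate a 0 (suc e)) (sym (corners-rotate (suc a) c (suc e)))
         (corners-rotate c 0 (suc a)) (sym (corners-rotate 0 e (suc a)))
         (sym (trans (corners-rotate (suc a) (suc c) e) (corners-rotate (suc c) e (suc a)))) ⟩
  corners a (suc c) (suc e) + corners (suc a) c (suc e) + corners (suc a) (suc c) e
    + (corners 0 a (suc c) + corners 0 (suc a) c) + (corners 0 e (suc a) + corners 0 (suc e) a) + corners 0 (suc c) (suc e) ∎
  where
  open ≡-Reasoning
  rearrange : ∀ A F {X₁ X₁' X₂ X₂' B B' Y₁ Y₁' Y₂ Y₂' E E'}
    → X₁ ≡ X₁' → X₂ ≡ X₂' → B ≡ B' → Y₁ ≡ Y₁' → Y₂ ≡ Y₂' → E ≡ E'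
    → (A + X₁ + X₂ + F) + ((B + Y₁ + Y₂) + (E + 0)) ≡ A + B' + E' + (X₁' + Y₁') + (Y₂' + X₂') + F
  rearrange A F {X₁} {_} {X₂} {_} {B} {_} {Y₁} {_} {Y₂} {_} {E} refl refl refl refl refl refl = regroup A X₁ X₂ F B Y₁ Y₂ E
    where
    regroup : ∀ A X₁ X₂ F B Y₁ Y₂ E
      → (A + X₁ + X₂ + F) + ((B + Y₁ + Y₂) + (E + 0)) ≡ A + B + E + (X₁ + Y₁) + (Y₂ + X₂) + F
    regroup = solve-∀

binom : ℕ → ℕ → ℕ
binom x y = (x + y) C x

binom-0ʳ : ∀ x → binom x 0 ≡ 1
binom-0ʳ x = trans (cong (_C x) (+-identityʳ x)) (nCn≡1 x)

binom-suc-suc : ∀ x y → binom (suc x) (suc y) ≡ binom x (suc y) + binom (suc x) y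
binom-suc-suc x y = sym (trans (cong (binom x (suc y) +_) (cong (_C suc x) (sym (+-suc x y))))
                               (nCk+nC[k+1]≡[n+1]C[k+1] (x + suc y) x))

binom-sym : ∀ x y → binom x y ≡ binom y x
binom-sym x y = trans (nCk≡nC[n∸k] (m≤m+n x y)) (trans (cong ((x + y) C_) (m+n∸m≡n x y)) (cong (_C y) (+-comm x y)))

binom-pair : ∀ x y → 2 * binom x (suc y) + 2 * binom (suc x) y ≡ 2 * binom (suc x) (suc y)
binom-pair x y = trans (sym (*-distribˡ-+ 2 (binom x (suc y)) (binom (suc x) y))) (cong (2 *_) (sym (binom-suc-suc x y)))

corners-face : ∀ x y → suc (corners 0 x y) ≡ 2 * binom x y
corners-face zero y = cong suc (corners-line₃ y)
corners-face (suc x) zero = trans (cong suc (corners-line₂ (suc x))) (cong (2 *_) (sym (binom-0ʳ (suc x))))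
corners-face (suc x) (suc y) = begin
  suc (corners 0 (suc x) (suc y))                       ≡⟨ cong suc (corners-face-suc x y) ⟩
  suc (1 + corners 0 x (suc y) + corners 0 (suc x) y)   ≡⟨ +-suc (suc (corners 0 x (suc y))) (corners 0 (suc x) y) ⟨
  suc (corners 0 x (suc y)) + suc (corners 0 (suc x) y) ≡⟨ cong₂ _+_ (corners-face x (suc y)) (corners-face (suc x) y) ⟩
  2 * binom x (suc y) + 2 * binom (suc x) y             ≡⟨ binom-pair x y ⟩
  2 * binom (suc x) (suc y) ∎
  where open ≡-Reasoning

corners-face-pair : ∀ x y → suc (corners 0 x (suc y)) + suc (corners 0 (suc x) y) ≡ 2 * binom (suc x) (suc y)
corners-face-pair x y = trans (cong₂ _+_ (corners-face x (suc y)) (corners-face (suc x) y)) (binom-pair x y)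

corners-flat : ∀ x y → corners 0 x y ≡ 2 * binom x y ∸ 1
corners-flat x y = cong (_∸ 1) (corners-face x y)

trinomial≡binom : ∀ n x y → n ≡ x + y → ((n !) / (x ! * y !)) {{x !* y !≢0}} ≡ binom x y
trinomial≡binom n x y refl = sym (trans (nCk≡n!/k![n-k]! (m≤m+n x y))
  (/-congʳ {{x !* ((x + y) ∸ x) !≢0}} {{x !* y !≢0}} (cong (λ t → x ! * t !) (m+n∸m≡n x y))))

trinomial-0₁ : ∀ y z → trinomial 0 y z ≡ binom y z
trinomial-0₁ y z = trans (/-congʳ {{m*n≢0 (1 * y !) (z !) {{m*n≢0 1 (y !) {{_}} {{y !≢0}}}} {{z !≢0}}}} {{y !* z !≢0}}
                              (cong (_* z !) (*-identityˡ (y !))))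
                         (trinomial≡binom (y + z) y z refl)

trinomial-0₂ : ∀ x z → trinomial x 0 z ≡ binom x z
trinomial-0₂ x z = trans (/-congʳ {{m*n≢0 (x ! * 1) (z !) {{m*n≢0 (x !) 1 {{x !≢0}} {{_}}}} {{z !≢0}}}} {{x !* z !≢0}}
                              (cong (_* z !) (*-identityʳ (x !))))
                         (trinomial≡binom (x + 0 + z) x z (cong (_+ z) (+-identityʳ x)))

trinomial-0₃ : ∀ x y → trinomial x y 0 ≡ binom x y
trinomial-0₃ x y = trans (/-congʳ {{m*n≢0 (x ! * y !) 1 {{x !* y !≢0}} {{_}}}} {{x !* y !≢0}} (*-identityʳ (x ! * y !)))
                         (trinomial≡binom (x + y + 0) x y (+-identityʳ (x + y)))

binom≡C : ∀ x y → (suc (suc x) + suc (suc y) ∸ 2) C (suc (suc x) ∸ 1) ≡ binom (suc x) (suc y)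
binom≡C x y = cong (_C suc x) (+-suc x (suc y))

-- The five flat terms of the recurrence contribute 2 p + 2 q + 2 r - 5.
recurrence-arith : ∀ A B E X₁ Y₁ X₂ Y₂ F {P Q R} → suc X₁ + suc Y₁ ≡ 2 * P → suc X₂ + suc Y₂ ≡ 2 * Q → suc F ≡ 2 * R
  → A + B + E + (X₁ + Y₁) + (X₂ + Y₂) + F ≡ (1 + 2 * P + 2 * Q + 2 * R + A + B + E) ∸ 6
recurrence-arith A B E X₁ Y₁ X₂ Y₂ F eP eQ eR rewrite sym eP | sym eQ | sym eR =
  trans (sym (m+n∸n≡m _ 6)) (cong (_∸ 6) (regroup A B E X₁ Y₁ X₂ Y₂ F))
  where
  regroup : ∀ A B E X₁ Y₁ X₂ Y₂ F → A + B + E + (X₁ + Y₁) + (X₂ + Y₂) + F + 6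
    ≡ 1 + (suc X₁ + suc Y₁) + (suc X₂ + suc Y₂) + suc F + A + B + E
  regroup = solve-∀

pc : ℕ → ℕ → ℕ → ℕ
pc b k h = corners (b ∸ 1) (k ∸ 1) (h ∸ 1)

pc-counts : ∀ b k h → 1 ≤ b → 1 ≤ k → 1 ≤ h → NumCornerPolyominoes b k h (pc b k h)
pc-counts (suc x) (suc y) (suc z) _ _ _ =
  card-⇔ (Bridge.cornerShape⇒isCorner x y z) (Bridge.isCorner⇒cornerShape x y z) (card-corners x y z)

pc-flat : ∀ b k h → 1 ≤ b → 1 ≤ k → 1 ≤ h → (b ≡ 1 ⊎ k ≡ 1 ⊎ h ≡ 1) →
  pc b k h ≡ 2 * trinomial (b ∸ 1) (k ∸ 1) (h ∸ 1) ∸ 1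
pc-flat (suc .0) (suc y) (suc z) _ _ _ (inj₁ refl) =
  trans (corners-flat y z) (cong (λ t → 2 * t ∸ 1) (sym (trinomial-0₁ y z)))
pc-flat (suc x) (suc .0) (suc z) _ _ _ (inj₂ (inj₁ refl)) =
  trans (corners-rotate x 0 z) (trans (corners-flat z x) (cong (λ t → 2 * t ∸ 1) (trans (binom-sym z x) (sym (trinomial-0₂ x z)))))
pc-flat (suc x) (suc y) (suc .0) _ _ _ (inj₂ (inj₂ refl)) =
  trans (sym (corners-rotate 0 x y)) (trans (corners-flat x y) (cong (λ t → 2 * t ∸ 1) (sym (trinomial-0₃ x y))))

pc-recurrence : ∀ b k h → b ≥ 2 → k ≥ 2 → h ≥ 2 →
  pc b k h ≡ (1 + 2 * ((b + k ∸ 2) C (b ∸ 1)) + 2 * ((b + h ∸ 2) C (b ∸ 1)) + 2 * ((k + h ∸ 2) C (k ∸ 1))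
              + pc (b ∸ 1) k h + pc b (k ∸ 1) h + pc b k (h ∸ 1)) ∸ 6
pc-recurrence (suc (suc a)) (suc (suc c)) (suc (suc e)) (s≤s (s≤s _)) (s≤s (s≤s _)) (s≤s (s≤s _)) =
  trans (corners-suc³ a c e) (recurrence-arith
    (corners a (suc c) (suc e)) (corners (suc a) c (suc e)) (corners (suc a) (suc c) e)
    (corners 0 a (suc c)) (corners 0 (suc a) c) (corners 0 e (suc a)) (corners 0 (suc e) a) (corners 0 (suc c) (suc e))
    {P = (b + k ∸ 2) C (b ∸ 1)} {Q = (b + h ∸ 2) C (b ∸ 1)} {R = (k + h ∸ 2) C (k ∸ 1)}
    (trans (corners-face-pair a c) (cong (2 *_) (sym (binom≡C a c))))
    (trans (corners-face-pair e a) (cong (2 *_) (trans (binom-sym (suc e) (suc a)) (sym (binom≡C a e)))))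
    (trans (corners-face (suc c) (suc e)) (cong (2 *_) (sym (binom≡C c e)))))
  where
  b k h : ℕ
  b = suc (suc a)
  k = suc (suc c)
  h = suc (suc e)

theorem1 : Σ (ℕ → ℕ → ℕ → ℕ) λ pc →
    (∀ b k h → 1 ≤ b → 1 ≤ k → 1 ≤ h → NumCornerPolyominoes b k h (pc b k h))
    × (∀ b k h → 1 ≤ b → 1 ≤ k → 1 ≤ h → (b ≡ 1 ⊎ k ≡ 1 ⊎ h ≡ 1) →
    pc b k h ≡ 2 * trinomial (b ∸ 1) (k ∸ 1) (h ∸ 1) ∸ 1)
    × (∀ b k h → b ≥ 2 → k ≥ 2 → h ≥ 2 →
    pc b k h ≡ (1 + 2 * ((b + k ∸ 2) C (b ∸ 1)) + 2 * ((b + h ∸ 2) C (b ∸ 1))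
    + 2 * ((k + h ∸ 2) C (k ∸ 1))
    + pc (b ∸ 1) k h + pc b (k ∸ 1) h + pc b k (h ∸ 1)) ∸ 6)
theorem1 = pc , pc-counts , pc-flat , pc-recurrence
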